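{- For integers $n \ge 2$ and $k \ge 0$, $$f_{n,k} + f_{n,k+1} = c_{n,k} + d_{n,k},$$ and moreover $$f_{n,2n-3} = c_{n,2n-3} = \frac{1}{n-1}{2n-4 \choose n-2}.$$ Here $c_{n,k}$ is the number of non-crossing connected graphs on $\{1,\ldots,n\}$ with $k$ edges, $f_{n,k}$ is the number of those containing the edge from $1$ to $n$, and $d_{n,k}$ is the number of non-crossing graphs on $\{1,\ldots,n\}$ with $k$ edges and exactly two connected components such that $1$ and $n$ lie in different components.
   Context: A non-crossing graph on $\{1,\ldots,n\}$ is a simple graph whose vertices $1,\ldots,n$ are placed in order around a circle, edges drawn as straight chords, with no two edges crossing. Isolated vertices count as connected components. -}

module Defs where

open import Data.Nat using (ℕ; zero; suc; _<_)
open import Data.Bool using (Bool; true)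
open import Data.Fin using (Fin; toℕ)
open import Data.Vec using (Vec; lookup)
open import Data.List using (List; length)
open import Data.Product using (Σ; _×_; ∃)
open import Data.Sum using (_⊎_)
open import Data.Empty using (⊥)
open import Relation.Nullary using (¬_)
open import Relation.Binary.PropositionalEquality using (_≡_)
open import Data.List.Membership.Propositional using (_∈_)
open import Data.List.Relation.Unary.Unique.Propositional using (Unique)
open import Function.Bundles using (_⇔_)

HasCount : {A : Set} → (A → Set) → ℕ → Set
HasCount {A} P m =
  Σ (List A) λ L → Unique L × (∀ x → (x ∈ L) ⇔ P x) × length L ≡ m

-- A graph on vertices Fin n (vertex i ∈ Fin n stands for i+1 ∈ {1..n}),
-- given by its adjacency matrix.
Graph : ℕ → Set
Graph n = Vec (Vec Bool n) n

Adj : {n : ℕ} → Graph n → Fin n → Fin n → Set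
Adj G i j = lookup (lookup G i) j ≡ true

Simple : {n : ℕ} → Graph n → Set
Simple {n} G = (∀ (i : Fin n) → ¬ Adj G i i) × (∀ (i j : Fin n) → Adj G i j → Adj G j i)

HasEdges : {n : ℕ} → ℕ → Graph n → Set
HasEdges {n} k G = HasCount {Fin n × Fin n} (λ p → toℕ (Data.Product.proj₁ p) < toℕ (Data.Product.proj₂ p) × Adj G (Data.Product.proj₁ p) (Data.Product.proj₂ p)) k

NonCrossing : {n : ℕ} → Graph n → Set
NonCrossing {n} G = ∀ (a b c d : Fin n) → Adj G a b → Adj G c d →
  toℕ a < toℕ c → toℕ c < toℕ b → toℕ b < toℕ d → ⊥

data Reach {n : ℕ} (G : Graph n) : Fin n → Fin n → Set where
  here : ∀ {i} → Reach G i i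
  step : ∀ {i j l} → Adj G i j → Reach G j l → Reach G i l

Connected : {n : ℕ} → Graph n → Set
Connected {n} G = ∀ (i j : Fin n) → Reach G i j

FirstLast : (n : ℕ) → Fin n → Fin n → Set
FirstLast n i j = toℕ i ≡ 0 × toℕ j ≡ Data.Nat._∸_ n 1

NCGraph : {n : ℕ} → ℕ → Graph n → Set
NCGraph k G = Simple G × NonCrossing G × HasEdges k G

-- non-crossing connected graphs with k edges  (counted by c_{n,k})
ConnNC : (n k : ℕ) → Graph n → Set
ConnNC n k G = NCGraph k G × Connected G

-- ... containing the edge {1,n}  (counted by f_{n,k})
ConnNCWithEdge : (n k : ℕ) → Graph n → Set
ConnNCWithEdge n k G = ConnNC n k G × (∀ i j → FirstLast n i j → Adj G i j)

-- non-crossing graphs with k edges and exactly two components, 1 and n in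
-- different components (counted by d_{n,k})
TwoCompNC : (n k : ℕ) → Graph n → Set
TwoCompNC n k G = NCGraph k G ×
  (∀ i j → FirstLast n i j → ¬ Reach G i j) ×
  (∀ v i j → FirstLast n i j → Reach G v i ⊎ Reach G v j)

module Submission where

-- Part 1, f_{n,k} + f_{n,k+1} = c_{n,k} + d_{n,k}: no chord crosses {1, n}, so adding
-- {1, n} is a bijection from the connected graphs with k edges avoiding {1, n} (g of them)
-- and the two-component graphs separating 1 from n (d_{n,k}) onto the graphs counted by
-- f_{n,k+1}; meanwhile c_{n,k} = f_{n,k} + g.
--
-- Part 2, f_{n,2n−3} = c_{n,2n−3} = Cat(n − 2): on m + 2 consecutive positions a
-- non-crossing graph has at most 2m + 1 edges (split the interval at the apex of its outer
-- chord).  Graphs attaining the bound are triangulations: they contain the outer chord,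
-- are connected, and are glued from triangulations of the two sides of the apex, which
-- gives Segner's recurrence for their number.

open import Defs
open import Data.Nat using (ℕ; suc; _+_; _*_; _∸_; _≤_)
open import Data.Nat.Combinatorics using (_C_)
open import Data.Product using (_×_; ∃)
open import Relation.Binary.PropositionalEquality using (_≡_)

module Counting where

  open import Defs using (HasCount)
  open import Data.Nat using (ℕ; zero; suc; _+_; _*_; _≤_; _<_; z≤n; s≤s)
  open import Data.Nat.Properties using (≤-antisym; +-suc; n≮0)
  open import Data.List using (List; []; _∷_; length; filter; map; _++_; [_]; cartesianProduct)
  open import Data.List.Properties using (length-++; length-map)
  open import Data.List.Membership.Propositional using (_∈_)
  open import Data.List.Membership.Propositional.Properties
    using (∈-∃++; ∈-++⁻; ∈-++⁺ˡ; ∈-++⁺ʳ; ∈-filter⁺; ∈-filter⁻; ∈-map⁺; ∈-map⁻;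
           ∈-cartesianProduct⁺; ∈-cartesianProduct⁻)
  open import Data.List.Relation.Unary.Any using (here; there)
  open import Data.List.Relation.Unary.All using (All; []; _∷_)
  open import Data.List.Relation.Unary.AllPairs using ([]; _∷_)
  open import Data.List.Relation.Unary.Unique.Propositional using (Unique)
  open import Data.List.Relation.Unary.Unique.Propositional.Properties
    using (filter⁺; ++⁺; cartesianProduct⁺)
  open import Data.Product using (Σ; _×_; _,_; proj₁; proj₂)
  open import Data.Sum using (_⊎_; inj₁; inj₂)
  import Data.Sum as Sum
  open import Data.Empty using (⊥; ⊥-elim)
  open import Relation.Nullary using (¬_)
  open import Relation.Unary using (Decidable)
  open import Relation.Binary.PropositionalEquality using (_≡_; refl; sym; trans; cong; cong₂; subst; _≢_)
  open import Function.Bundles using (mk⇔; Equivalence)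

  open Equivalence using (to; from)

  module _ {A : Set} where

    private
      ∈-remove : ∀ {x y : A} ys zs → y ∈ ys ++ (x ∷ zs) → y ≢ x → y ∈ ys ++ zs
      ∈-remove []       zs (here y≡x) y≢x = ⊥-elim (y≢x y≡x)
      ∈-remove []       zs (there y∈) y≢x = y∈
      ∈-remove (w ∷ ys) zs (here y≡w) y≢x = here y≡w
      ∈-remove (w ∷ ys) zs (there y∈) y≢x = there (∈-remove ys zs y∈ y≢x)

      ∉-All≢ : ∀ {x : A} {xs} → All (x ≢_) xs → x ∈ xs → ⊥
      ∉-All≢ (x≢y ∷ _)  (here x≡y) = x≢y x≡y
      ∉-All≢ (_ ∷ x≢ys) (there x∈) = ∉-All≢ x≢ys x∈

    unique-⊆-length : ∀ {xs ys : List A} → Unique xs → (∀ {x} → x ∈ xs → x ∈ ys) →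
                      length xs ≤ length ys
    unique-⊆-length {[]} _ _ = z≤n
    unique-⊆-length {x ∷ xs} {ys} (x∉xs ∷ u) sub with ∈-∃++ (sub (here refl))
    ... | ys₁ , ys₂ , refl =
      subst (suc (length xs) ≤_) (sym (trans (length-++ ys₁) (+-suc (length ys₁) (length ys₂))))
        (s≤s (subst (length xs ≤_) (length-++ ys₁)
          (unique-⊆-length u (λ {y} y∈xs → ∈-remove ys₁ ys₂ (sub (there y∈xs))
            (λ y≡x → ∉-All≢ x∉xs (subst (_∈ xs) y≡x y∈xs))))))

    count-≤ : ∀ {P Q : A → Set} {a b} → HasCount P a → HasCount Q b → (∀ x → P x → Q x) → a ≤ b
    count-≤ (L , uL , mL , refl) (M , _ , mM , refl) P⊆Q =
      unique-⊆-length uL (λ {x} x∈L → from (mM x) (P⊆Q x (to (mL x) x∈L)))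

    count-unique : ∀ {P : A → Set} {a b} → HasCount P a → HasCount P b → a ≡ b
    count-unique ca cb = ≤-antisym (count-≤ ca cb (λ _ p → p)) (count-≤ cb ca (λ _ p → p))

    count-resp : ∀ {P Q : A → Set} {a} → (∀ x → P x → Q x) → (∀ x → Q x → P x) →
                 HasCount P a → HasCount Q a
    count-resp P→Q Q→P (L , uL , mL , eq) =
      L , uL , (λ x → mk⇔ (λ x∈L → P→Q x (to (mL x) x∈L)) (λ q → from (mL x) (Q→P x q))) , eq

    count-filter : (xs : List A) → Unique xs → (∀ x → x ∈ xs) → {P : A → Set} (P? : Decidable P) →
                   HasCount P (length (filter P? xs))
    count-filter xs u complete P? =
      filter P? xs , filter⁺ P? u ,
      (λ x → mk⇔ (λ x∈ → proj₂ (∈-filter⁻ P? {xs = xs} x∈)) (∈-filter⁺ P? (complete x))) ,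
      refl

    count-⊎ : ∀ {P Q : A → Set} {a b} → HasCount P a → HasCount Q b → (∀ x → P x → Q x → ⊥) →
              HasCount (λ x → P x ⊎ Q x) (a + b)
    count-⊎ (L , uL , mL , refl) (M , uM , mM , refl) disjoint =
      L ++ M , ++⁺ uL uM (λ {x} (x∈L , x∈M) → disjoint x (to (mL x) x∈L) (to (mM x) x∈M)) ,
      (λ x → mk⇔ (λ x∈ → Sum.map (to (mL x)) (to (mM x)) (∈-++⁻ L x∈))
                 (λ { (inj₁ p) → ∈-++⁺ˡ (from (mL x) p) ; (inj₂ q) → ∈-++⁺ʳ L (from (mM x) q) })) ,
      length-++ L

    count-single : (x₀ : A) → HasCount (_≡ x₀) 1
    count-single x₀ = [ x₀ ] , [] ∷ [] , (λ x → mk⇔ (λ { (here p) → p ; (there ()) }) here) , refl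

    count-empty : ∀ {P : A → Set} → (∀ x → ¬ P x) → HasCount P 0
    count-empty ¬P = [] , [] , (λ x → mk⇔ (λ ()) (λ p → ⊥-elim (¬P x p))) , refl

    count-≤1 : ∀ {P : A → Set} {a} → HasCount P a → (∀ x y → P x → P y → x ≡ y) → a ≤ 1
    count-≤1 ([] , _ , _ , refl) _ = z≤n
    count-≤1 (_ ∷ [] , _ , _ , refl) _ = s≤s z≤n
    count-≤1 (x ∷ y ∷ _ , ((x≢y ∷ _) ∷ _) , mL , refl) atMostOne =
      ⊥-elim (x≢y (atMostOne x y (to (mL x) (here refl)) (to (mL y) (there (here refl)))))

    count-witness : ∀ {P : A → Set} {a} → HasCount P (suc a) → Σ A P
    count-witness (x ∷ _ , _ , mL , _) = x , to (mL x) (here refl)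

  module _ {X A : Set} where

    private
      map-unique : (f : X → A) (L : List X) → Unique L →
                   (∀ {x y} → x ∈ L → y ∈ L → f x ≡ f y → x ≡ y) → Unique (map f L)
      map-unique f [] _ _ = []
      map-unique f (x ∷ L) (x∉L ∷ u) inj =
        distinct x∉L (λ y∈L → inj (here refl) (there y∈L)) ∷ map-unique f L u (λ p q → inj (there p) (there q))
        where
        distinct : ∀ {M} → All (x ≢_) M → (∀ {y} → y ∈ M → f x ≡ f y → x ≡ y) → All (f x ≢_) (map f M)
        distinct [] _ = []
        distinct (x≢y ∷ x≢M) injM = (λ e → x≢y (injM (here refl) e)) ∷ distinct x≢M (λ p → injM (there p))

    count-image : ∀ {P : X → Set} (Q : A → Set) {a} (f : X → A) → HasCount P a →
                  (∀ x y → P x → P y → f x ≡ f y → x ≡ y) →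
                  (∀ x → P x → Q (f x)) → (∀ y → Q y → Σ X λ x → P x × f x ≡ y) → HasCount Q a
    count-image Q f (L , uL , mL , refl) inj into onto =
      map f L ,
      map-unique f L uL (λ {x} {y} x∈ y∈ → inj x y (to (mL x) x∈) (to (mL y) y∈)) ,
      (λ y → mk⇔ (λ y∈ → let (x , x∈ , y≡fx) = ∈-map⁻ f y∈ in subst Q (sym y≡fx) (into x (to (mL x) x∈)))
                 (λ q → let (x , p , fx≡y) = onto y q in subst (_∈ map f L) fx≡y (∈-map⁺ f (from (mL x) p)))) ,
      length-map f L

  module _ {X Y : Set} where

    private
      length-cartesianProduct : (L : List X) (M : List Y) → length (cartesianProduct L M) ≡ length L * length M
      length-cartesianProduct []      M = refl
      length-cartesianProduct (x ∷ L) M =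
        trans (length-++ (map (x ,_) M)) (cong₂ _+_ (length-map (x ,_) M) (length-cartesianProduct L M))

    count-× : ∀ {P : X → Set} {Q : Y → Set} {a b} → HasCount P a → HasCount Q b →
              HasCount (λ p → P (proj₁ p) × Q (proj₂ p)) (a * b)
    count-× (L , uL , mL , refl) (M , uM , mM , refl) =
      cartesianProduct L M , cartesianProduct⁺ uL uM ,
      (λ { (x , y) → mk⇔ (λ p∈ → let (x∈ , y∈) = ∈-cartesianProduct⁻ L M p∈ in to (mL x) x∈ , to (mM y) y∈)
                          (λ { (p , q) → ∈-cartesianProduct⁺ (from (mL x) p) (from (mM y) q) }) }) ,
      length-cartesianProduct L M

  sumBelow : ℕ → (ℕ → ℕ) → ℕ
  sumBelow zero    c = 0
  sumBelow (suc l) c = c 0 + sumBelow l (λ j → c (suc j))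

  count-Σ : {X : Set} (R : ℕ → X → Set) (c : ℕ → ℕ) (len : ℕ) → (∀ j → j < len → HasCount (R j) (c j)) →
            HasCount (λ (p : ℕ × X) → proj₁ p < len × R (proj₁ p) (proj₂ p)) (sumBelow len c)
  count-Σ R c zero _ = count-empty (λ p q → n≮0 (proj₁ q))
  count-Σ {X} R c (suc len) counts =
    count-resp (λ { (j , x) (inj₁ (refl , r)) → s≤s z≤n , r
                  ; (zero , x) (inj₂ ())
                  ; (suc j , x) (inj₂ (j<len , r)) → s≤s j<len , r })
               (λ { (zero , x) (_ , r) → inj₁ (refl , r) ; (suc j , x) (s≤s j<len , r) → inj₂ (j<len , r) })
               (count-⊎ atZero atSuc (λ { (zero , x) _ () ; (suc j , x) () _ }))
    where
    Shifted : ℕ × X → Set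
    Shifted (zero , x)  = ⊥
    Shifted (suc j , x) = j < len × R (suc j) x
    atZero : HasCount (λ (p : ℕ × X) → proj₁ p ≡ 0 × R 0 (proj₂ p)) (c 0)
    atZero = count-image _ (0 ,_) (counts 0 (s≤s z≤n)) (λ x y _ _ e → cong proj₂ e)
               (λ x r → refl , r) (λ { (zero , x) (refl , r) → x , r , refl })
    atSuc : HasCount Shifted (sumBelow len (λ j → c (suc j)))
    atSuc = count-image _ (λ p → suc (proj₁ p) , proj₂ p)
              (count-Σ (λ j → R (suc j)) (λ j → c (suc j)) len (λ j j<len → counts (suc j) (s≤s j<len)))
              (λ { (j , x) (j' , x') _ _ refl → refl })
              (λ { (j , x) r → r })
              (λ { (zero , x) () ; (suc j , x) r → (j , x) , r , refl })

module FiniteGraphs where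

  open import Defs
  open Counting
  open import Data.Nat using (ℕ; zero; suc; _+_; _∸_; _≤_; _<_; _<?_; s≤s)
  import Data.Nat as ℕ
  open import Data.Nat.Properties using (≤-reflexive; ≤-total; <-trans; <-≤-trans; <-irrefl; m∸n+n≡m)
  open import Data.Bool using (Bool; true; false)
  import Data.Bool as Bool
  open import Data.Fin using (Fin; toℕ)
  open import Data.Fin.Properties using (all?; any?)
  open import Data.Fin.Subset using (Subset; _∈_; _⊆_; ⁅_⁆; ∣_∣)
  open import Data.Fin.Subset.Properties using (_∈?_; x∈⁅x⁆; x∈⁅y⁆⇒x≡y; ∣⁅x⁆∣≡1; ∣p∣≤n; p⊂q⇒∣p∣<∣q∣)
  open import Data.Vec using (Vec; []; _∷_; lookup; tabulate)
  open import Data.Vec.Properties using (lookup∘tabulate; tabulate∘lookup; tabulate-cong; ∷-injective;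
                                         []=⇒lookup; lookup⇒[]=)
  open import Data.List using (List; []; _∷_; length; filter; cartesianProductWith; cartesianProduct; allFin; [_])
  open import Data.List.Membership.Propositional using () renaming (_∈_ to _∈ₗ_)
  open import Data.List.Membership.Propositional.Properties using (∈-cartesianProductWith⁺; ∈-cartesianProduct⁺; ∈-allFin)
  open import Data.List.Relation.Unary.Any using (here; there)
  open import Data.List.Relation.Unary.AllPairs using ([]; _∷_)
  open import Data.List.Relation.Unary.All using ([]; _∷_)
  open import Data.List.Relation.Unary.Unique.Propositional using (Unique)
  open import Data.List.Relation.Unary.Unique.Propositional.Properties using (cartesianProductWith⁺; cartesianProduct⁺; allFin⁺)
  open import Data.Product using (_×_; _,_; proj₁; proj₂; ∃)
  open import Data.Sum using (_⊎_; inj₁; inj₂)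
  open import Data.Empty using (⊥-elim)
  open import Relation.Unary using (Decidable)
  open import Relation.Nullary using (yes; no; Dec; does)
  open import Relation.Nullary.Decidable using (_×-dec_; _⊎-dec_; _→-dec_; ¬?; dec-true)
  open import Relation.Binary.PropositionalEquality using (_≡_; refl; sym; trans; cong; subst; module ≡-Reasoning)

  does-true : ∀ {P : Set} (P? : Dec P) → does P? ≡ true → P
  does-true (yes p) _ = p

  allVecs : {A : Set} (n : ℕ) → List A → List (Vec A n)
  allVecs zero    xs = [ [] ]
  allVecs (suc n) xs = cartesianProductWith _∷_ xs (allVecs n xs)

  allVecs-unique : {A : Set} (n : ℕ) (xs : List A) → Unique xs → Unique (allVecs n xs)
  allVecs-unique zero    xs _ = [] ∷ []
  allVecs-unique (suc n) xs u = cartesianProductWith⁺ _∷_ ∷-injective u (allVecs-unique n xs u)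

  allVecs-complete : {A : Set} (n : ℕ) (xs : List A) → (∀ x → x ∈ₗ xs) → ∀ v → v ∈ₗ allVecs n xs
  allVecs-complete zero    xs _ [] = here refl
  allVecs-complete (suc n) xs complete (x ∷ v) =
    ∈-cartesianProductWith⁺ _∷_ (complete x) (allVecs-complete n xs complete v)

  bools : List Bool
  bools = true ∷ false ∷ []

  allGraphs : (n : ℕ) → List (Graph n)
  allGraphs n = allVecs n (allVecs n bools)

  count-graphs : ∀ {n} {P : Graph n → Set} → Decidable P → ∃ λ c → HasCount P c
  count-graphs {n} P? = _ , count-filter (allGraphs n) allGraphs-unique (allVecs-complete n _ (allVecs-complete n bools bools-complete)) P?
    where
    bools-complete : ∀ b → b ∈ₗ bools
    bools-complete true  = here refl
    bools-complete false = there (here refl)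
    allGraphs-unique : Unique (allGraphs n)
    allGraphs-unique = allVecs-unique n _ (allVecs-unique n bools (((λ ()) ∷ []) ∷ [] ∷ []))

  module _ {n : ℕ} where

    subsetOf : {P : Fin n → Set} → Decidable P → Subset n
    subsetOf P? = tabulate (λ j → does (P? j))

    ∈-subsetOf : ∀ {P : Fin n → Set} (P? : Decidable P) {j} → j ∈ subsetOf P? → P j
    ∈-subsetOf P? {j} j∈ = does-true (P? j) (trans (sym (lookup∘tabulate _ j)) ([]=⇒lookup j∈))

    subsetOf-∈ : ∀ {P : Fin n → Set} (P? : Decidable P) {j} → P j → j ∈ subsetOf P?
    subsetOf-∈ P? {j} p = lookup⇒[]= j _ (trans (lookup∘tabulate _ j) (dec-true (P? j) p))

    graphOf : {R : Fin n → Fin n → Set} → (∀ i j → Dec (R i j)) → Graph n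
    graphOf R? = tabulate (λ i → subsetOf (R? i))

    adj-graphOf : ∀ {R : Fin n → Fin n → Set} (R? : ∀ i j → Dec (R i j)) {i j} → Adj (graphOf R?) i j → R i j
    adj-graphOf R? {i} {j} a =
      ∈-subsetOf (R? i) (lookup⇒[]= j _ (trans (cong (λ row → lookup row j) (sym (lookup∘tabulate _ i))) a))

    graphOf-adj : ∀ {R : Fin n → Fin n → Set} (R? : ∀ i j → Dec (R i j)) {i j} → R i j → Adj (graphOf R?) i j
    graphOf-adj R? {i} {j} r =
      trans (cong (λ row → lookup row j) (lookup∘tabulate _ i)) ([]=⇒lookup (subsetOf-∈ (R? i) r))

    graph-ext : ∀ {G H : Graph n} → (∀ i j → Adj G i j → Adj H i j) → (∀ i j → Adj H i j → Adj G i j) → G ≡ H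
    graph-ext {G} {H} G⊆H H⊆G = begin
      G                                                     ≡⟨ sym (rows G) ⟩
      tabulate (λ i → tabulate (λ j → lookup (lookup G i) j)) ≡⟨ tabulate-cong (λ i → tabulate-cong (λ j → entry i j)) ⟩
      tabulate (λ i → tabulate (λ j → lookup (lookup H i) j)) ≡⟨ rows H ⟩
      H                                                     ∎
      where
      open ≡-Reasoning
      rows : ∀ K → tabulate (λ i → tabulate (λ j → lookup (lookup K i) j)) ≡ K
      rows K = trans (tabulate-cong (λ i → tabulate∘lookup (lookup K i))) (tabulate∘lookup K)
      same : ∀ {b c : Bool} → (b ≡ true → c ≡ true) → (c ≡ true → b ≡ true) → b ≡ c
      same {true}  {true}  _ _ = refl
      same {true}  {false} f _ = sym (f refl)
      same {false} {true}  _ g = g refl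
      same {false} {false} _ _ = refl
      entry : ∀ i j → lookup (lookup G i) j ≡ lookup (lookup H i) j
      entry i j = same (G⊆H i j) (H⊆G i j)

    adj? : (G : Graph n) → ∀ i j → Dec (Adj G i j)
    adj? G i j = lookup (lookup G i) j Bool.≟ true

    Chord : ℕ → ℕ → Fin n → Fin n → Set
    Chord a b i j = (toℕ i ≡ a × toℕ j ≡ b) ⊎ (toℕ i ≡ b × toℕ j ≡ a)

    chord? : ∀ a b i j → Dec (Chord a b i j)
    chord? a b i j = ((toℕ i ℕ.≟ a) ×-dec (toℕ j ℕ.≟ b)) ⊎-dec ((toℕ i ℕ.≟ b) ×-dec (toℕ j ℕ.≟ a))

    chord-sym : ∀ {a b i j} → Chord a b i j → Chord a b j i
    chord-sym (inj₁ (i≡a , j≡b)) = inj₂ (j≡b , i≡a)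
    chord-sym (inj₂ (i≡b , j≡a)) = inj₁ (j≡a , i≡b)

    chord-ordered : ∀ {a b i j} → a < b → toℕ i < toℕ j → Chord a b i j → toℕ i ≡ a × toℕ j ≡ b
    chord-ordered a<b i<j (inj₁ ends) = ends
    chord-ordered a<b i<j (inj₂ (refl , refl)) = ⊥-elim (<-irrefl refl (<-trans a<b i<j))

    nonCrossing-⊆ : ∀ {G H : Graph n} → (∀ i j → Adj H i j → Adj G i j) → NonCrossing G → NonCrossing H
    nonCrossing-⊆ H⊆G nc a b c d ab cd = nc a b c d (H⊆G a b ab) (H⊆G c d cd)

    simple? : (G : Graph n) → Dec (Simple G)
    simple? G = all? (λ i → ¬? (adj? G i i)) ×-dec all? (λ i → all? (λ j → adj? G i j →-dec adj? G j i))

    nonCrossing? : (G : Graph n) → Dec (NonCrossing G)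
    nonCrossing? G = all? λ a → all? λ b → all? λ c → all? λ d →
      adj? G a b →-dec adj? G c d →-dec (toℕ a <? toℕ c) →-dec (toℕ c <? toℕ b) →-dec (toℕ b <? toℕ d) →-dec no (λ ())

    allPairs : List (Fin n × Fin n)
    allPairs = cartesianProduct (allFin n) (allFin n)

    count-pairs : {P : Fin n × Fin n → Set} (P? : Decidable P) → HasCount P (length (filter P? allPairs))
    count-pairs = count-filter allPairs (cartesianProduct⁺ (allFin⁺ n) (allFin⁺ n))
                    (λ (i , j) → ∈-cartesianProduct⁺ (∈-allFin i) (∈-allFin j))

    isEdge? : (G : Graph n) → Decidable (λ (p : Fin n × Fin n) → toℕ (proj₁ p) < toℕ (proj₂ p) × Adj G (proj₁ p) (proj₂ p))
    isEdge? G (i , j) = (toℕ i <? toℕ j) ×-dec adj? G i j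

    edgeCount : Graph n → ℕ
    edgeCount G = length (filter (isEdge? G) allPairs)

    hasEdges-edgeCount : ∀ G → HasEdges (edgeCount G) G
    hasEdges-edgeCount G = count-pairs (isEdge? G)

    hasEdges? : ∀ k G → Dec (HasEdges k G)
    hasEdges? k G with edgeCount G ℕ.≟ k
    ... | yes refl = yes (hasEdges-edgeCount G)
    ... | no  ≢k   = no (λ hk → ≢k (count-unique (hasEdges-edgeCount G) hk))

    ncGraph? : ∀ k G → Dec (NCGraph k G)
    ncGraph? k G = simple? G ×-dec nonCrossing? G ×-dec hasEdges? k G

    reach-snoc : ∀ {G : Graph n} {i j l} → Reach G i j → Adj G j l → Reach G i l
    reach-snoc here       a = step a here
    reach-snoc (step x r) a = step x (reach-snoc r a)

    reach-trans : ∀ {G : Graph n} {i j l} → Reach G i j → Reach G j l → Reach G i l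
    reach-trans here       r = r
    reach-trans (step x r) r' = step x (reach-trans r r')

    reach-sym : ∀ {G : Graph n} {i j} → (∀ a b → Adj G a b → Adj G b a) → Reach G i j → Reach G j i
    reach-sym sym-adj here       = here
    reach-sym sym-adj (step x r) = reach-snoc (reach-sym sym-adj r) (sym-adj _ _ x)

    reach-mono : ∀ {G H : Graph n} {i j} → (∀ a b → Adj G a b → Adj H a b) → Reach G i j → Reach H i j
    reach-mono G⊆H here       = here
    reach-mono G⊆H (step x r) = step (G⊆H _ _ x) (reach-mono G⊆H r)

    connected-via : ∀ {G : Graph n} (hub : Fin n) → (∀ a b → Adj G a b → Adj G b a) →
                    (∀ v → Reach G v hub) → Connected G
    connected-via hub sym-adj toHub i j = reach-trans (toHub i) (reach-sym sym-adj (toHub j))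

  -- The balls of radius t
  -- around i₀ increase with t; as long as they strictly increase their size grows,
  -- and sizes are bounded by n, so some ball is closed under taking neighbours and
  -- then contains every vertex reachable from i₀.
  module Reachability {n : ℕ} (G : Graph n) (i₀ : Fin n) where

    Near : Subset n → Fin n → Set
    Near S j = j ∈ S ⊎ ∃ λ v → v ∈ S × Adj G v j

    near? : ∀ S → Decidable (Near S)
    near? S j = (j ∈? S) ⊎-dec any? (λ v → (v ∈? S) ×-dec adj? G v j)

    expand : Subset n → Subset n
    expand S = subsetOf (near? S)

    expand-mono : ∀ {S T} → S ⊆ T → expand S ⊆ expand T
    expand-mono {S} {T} S⊆T j∈ with ∈-subsetOf (near? S) j∈
    ... | inj₁ j∈S           = subsetOf-∈ (near? T) (inj₁ (S⊆T j∈S))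
    ... | inj₂ (v , v∈S , a) = subsetOf-∈ (near? T) (inj₂ (v , S⊆T v∈S , a))

    ball : ℕ → Subset n
    ball zero    = ⁅ i₀ ⁆
    ball (suc t) = expand (ball t)

    ball-⊆ : ∀ d {t} → ball t ⊆ ball (d + t)
    ball-⊆ zero    j∈ = j∈
    ball-⊆ (suc d) j∈ = subsetOf-∈ (near? _) (inj₁ (ball-⊆ d j∈))

    ball-sound : ∀ t {j} → j ∈ ball t → Reach G i₀ j
    ball-sound zero    j∈ with x∈⁅y⁆⇒x≡y i₀ j∈
    ... | refl = here
    ball-sound (suc t) j∈ with ∈-subsetOf (near? (ball t)) j∈
    ... | inj₁ j∈ball       = ball-sound t j∈ball
    ... | inj₂ (v , v∈ , a) = reach-snoc (ball-sound t v∈) a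

    ball-complete : ∀ t {j l} → j ∈ ball t → Reach G j l → ∃ λ u → l ∈ ball u
    ball-complete t j∈ here       = t , j∈
    ball-complete t j∈ (step a r) = ball-complete (suc t) (subsetOf-∈ (near? (ball t)) (inj₂ (_ , j∈ , a))) r

    closed-stays : ∀ {t₀} → ball (suc t₀) ⊆ ball t₀ → ∀ d → ball (d + t₀) ⊆ ball t₀
    closed-stays closed zero    j∈ = j∈
    closed-stays closed (suc d) j∈ = closed (expand-mono (closed-stays closed d) j∈)

    growth : ∀ t → (∃ λ t₀ → ball (suc t₀) ⊆ ball t₀) ⊎ suc t ≤ ∣ ball t ∣
    growth zero = inj₂ (≤-reflexive (sym (∣⁅x⁆∣≡1 i₀)))
    growth (suc t) with growth t
    ... | inj₁ closed = inj₁ closed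
    ... | inj₂ big with any? (λ x → (x ∈? ball (suc t)) ×-dec ¬? (x ∈? ball t))
    ...   | yes new = inj₂ (<-≤-trans (s≤s big) (p⊂q⇒∣p∣<∣q∣ ((λ j∈ → ball-⊆ 1 {t} j∈) , proj₁ new , proj₂ new)))
    ...   | no none = inj₁ (t , λ {x} x∈ → inBall x x∈)
      where
      inBall : ∀ x → x ∈ ball (suc t) → x ∈ ball t
      inBall x x∈ with x ∈? ball t
      ... | yes x∈t = x∈t
      ... | no  x∉t = ⊥-elim (none (x , x∈ , x∉t))

    -- Since a ball has at most n vertices, some ball is closed.
    closedBall : ∃ λ t₀ → ball (suc t₀) ⊆ ball t₀
    closedBall with growth n
    ... | inj₁ closed = closed
    ... | inj₂ big    = ⊥-elim (<-irrefl refl (<-≤-trans big (∣p∣≤n (ball n))))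

    ball-⊆-closed : ∀ {t₀} → ball (suc t₀) ⊆ ball t₀ → ∀ u {j} → j ∈ ball u → j ∈ ball t₀
    ball-⊆-closed {t₀} closed u {j} j∈ with ≤-total u t₀
    ... | inj₁ u≤t₀ = subst (λ s → j ∈ ball s) (m∸n+n≡m u≤t₀) (ball-⊆ (t₀ ∸ u) j∈)
    ... | inj₂ t₀≤u = closed-stays closed (u ∸ t₀) (subst (λ s → j ∈ ball s) (sym (m∸n+n≡m t₀≤u)) j∈)

    reach? : ∀ j → Dec (Reach G i₀ j)
    reach? j with closedBall
    ... | t₀ , closed with j ∈? ball t₀
    ...   | yes j∈ = yes (ball-sound t₀ j∈)
    ...   | no  j∉ = no λ r → let (u , j∈u) = ball-complete 0 (x∈⁅x⁆ i₀) r in j∉ (ball-⊆-closed {t₀} closed u j∈u)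

  reach? : ∀ {n} (G : Graph n) i j → Dec (Reach G i j)
  reach? G i = Reachability.reach? G i

  connected? : ∀ {n} (G : Graph n) → Dec (Connected G)
  connected? G = all? λ i → all? λ j → reach? G i j

module OuterChord where

  open import Defs
  open Counting
  open FiniteGraphs
  open import Data.Nat using (ℕ; zero; suc; _+_; _<_; z≤n; s≤s)
  open import Data.Nat.Properties using (+-assoc; suc-injective; n≮0; <-irrefl; ≤-<-trans; ≤-pred; 0≢1+n)
  open import Data.Fin using (Fin; zero; toℕ; fromℕ)
  open import Data.Fin.Properties using (toℕ-injective; toℕ-fromℕ; toℕ<n; all?)
  open import Data.Product using (_×_; _,_; proj₁; proj₂; ∃)
  open import Data.Sum using (_⊎_; inj₁; inj₂; [_,_]′)
  import Data.Sum as Sum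
  open import Data.Empty using (⊥; ⊥-elim)
  open import Relation.Nullary using (¬_; yes; no; Dec)
  open import Relation.Nullary.Decidable using (_×-dec_; _⊎-dec_; ¬?; map′; toSum)
  open import Relation.Binary.PropositionalEquality using (_≡_; refl; sym; trans; cong; cong₂; subst; subst₂; module ≡-Reasoning)

  -- Throughout, the vertices are 1, …, n with n = m + 2, i.e. positions 0, …, m + 1.
  module _ (m : ℕ) where

    private
      n : ℕ
      n = suc (suc m)

    first last : Fin n
    first = zero
    last  = fromℕ (suc m)

    firstLast : FirstLast n first last
    firstLast = refl , toℕ-fromℕ (suc m)

    firstLast-unique : ∀ {i j} → FirstLast n i j → i ≡ first × j ≡ last
    firstLast-unique (i≡0 , j≡n-1) = toℕ-injective i≡0 , toℕ-injective (trans j≡n-1 (sym (toℕ-fromℕ (suc m))))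

    atEnds : {P : Fin n → Fin n → Set} → P first last → ∀ i j → FirstLast n i j → P i j
    atEnds p i j fl with firstLast-unique fl
    ... | refl , refl = p

    Outer : Fin n → Fin n → Set
    Outer = Chord 0 (suc m)

    outer? : ∀ i j → Dec (Outer i j)
    outer? = chord? 0 (suc m)

    outer-first-last : Outer first last
    outer-first-last = inj₁ firstLast

    outer-irrefl : ∀ {i} → ¬ Outer i i
    outer-irrefl (inj₁ (i≡0 , i≡n-1)) = 0≢1+n (trans (sym i≡0) i≡n-1)
    outer-irrefl (inj₂ (i≡n-1 , i≡0)) = 0≢1+n (trans (sym i≡0) i≡n-1)

    last-maximal : ∀ (v : Fin n) → ¬ suc m < toℕ v
    last-maximal v m+1<v = <-irrefl refl (≤-<-trans (≤-pred (toℕ<n v)) m+1<v)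

    -- No chord crosses the outer chord: it joins the two extreme positions.
    outer-uncrossed : ∀ {a b c d : Fin n} → Outer a b ⊎ Outer c d →
                      toℕ a < toℕ c → toℕ c < toℕ b → toℕ b < toℕ d → ⊥
    outer-uncrossed {d = d} (inj₁ (inj₁ (_ , b≡n-1))) _ _ b<d = last-maximal d (subst (_< toℕ d) b≡n-1 b<d)
    outer-uncrossed (inj₁ (inj₂ (_ , b≡0))) _ c<b _ = n≮0 (subst (_ <_) b≡0 c<b)
    outer-uncrossed (inj₂ (inj₁ (c≡0 , _))) a<c _ _ = n≮0 (subst (_ <_) c≡0 a<c)
    outer-uncrossed {b = b} (inj₂ (inj₂ (c≡n-1 , _))) _ c<b _ = last-maximal b (subst (_< toℕ b) c≡n-1 c<b)

    withOuter? : (G : Graph n) → ∀ i j → Dec (Adj G i j ⊎ Outer i j)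
    withOuter? G i j = adj? G i j ⊎-dec outer? i j

    withoutOuter? : (G : Graph n) → ∀ i j → Dec (Adj G i j × ¬ Outer i j)
    withoutOuter? G i j = adj? G i j ×-dec ¬? (outer? i j)

    addOuter removeOuter : Graph n → Graph n
    addOuter G    = graphOf (withOuter? G)
    removeOuter G = graphOf (withoutOuter? G)

    addOuter-⊇ : ∀ G {i j} → Adj G i j → Adj (addOuter G) i j
    addOuter-⊇ G a = graphOf-adj (withOuter? G) (inj₁ a)

    removeOuter-⊆ : ∀ G {i j} → Adj (removeOuter G) i j → Adj G i j
    removeOuter-⊆ G a = proj₁ (adj-graphOf (withoutOuter? G) a)

    NoOuter : Graph n → Set
    NoOuter G = ∀ i j → Outer i j → ¬ Adj G i j

    noOuter : ∀ {G} → Simple G → ¬ Adj G first last → NoOuter G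
    noOuter {G} s ¬a i j (inj₁ ends) a =
      ¬a (subst₂ (Adj G) (proj₁ (firstLast-unique ends)) (proj₂ (firstLast-unique ends)) a)
    noOuter {G} s ¬a i j (inj₂ (i≡n-1 , j≡0)) a = noOuter {G} s ¬a j i (inj₁ (j≡0 , i≡n-1)) (proj₂ s i j a)

    removeOuter-addOuter : ∀ G → NoOuter G → removeOuter (addOuter G) ≡ G
    removeOuter-addOuter G noO = graph-ext
      (λ i j a → let (a⁺ , ¬o) = adj-graphOf (withoutOuter? (addOuter G)) a
                 in [ (λ x → x) , (λ o → ⊥-elim (¬o o)) ]′ (adj-graphOf (withOuter? G) a⁺))
      (λ i j a → graphOf-adj (withoutOuter? (addOuter G)) (addOuter-⊇ G a , λ o → noO i j o a))

    addOuter-removeOuter : ∀ G → (∀ i j → Outer i j → Adj G i j) → addOuter (removeOuter G) ≡ G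
    addOuter-removeOuter G hasO = graph-ext
      (λ i j a → [ removeOuter-⊆ G , hasO i j ]′ (adj-graphOf (withOuter? (removeOuter G)) a))
      (λ i j a → graphOf-adj (withOuter? (removeOuter G)) (helper i j a))
      where
      helper : ∀ i j → Adj G i j → Adj (removeOuter G) i j ⊎ Outer i j
      helper i j a with outer? i j
      ... | yes o = inj₂ o
      ... | no ¬o = inj₁ (graphOf-adj (withoutOuter? G) (a , ¬o))

    addOuter-simple : ∀ {G} → Simple G → Simple (addOuter G)
    addOuter-simple {G} (irr , sym-adj) =
      (λ i a → [ irr i , outer-irrefl ]′ (adj-graphOf (withOuter? G) a)) ,
      (λ i j a → graphOf-adj (withOuter? G) (Sum.map (sym-adj i j) chord-sym (adj-graphOf (withOuter? G) a)))

    removeOuter-simple : ∀ {G} → Simple G → Simple (removeOuter G)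
    removeOuter-simple {G} (irr , sym-adj) =
      (λ i a → irr i (removeOuter-⊆ G a)) ,
      (λ i j a → let (a′ , ¬o) = adj-graphOf (withoutOuter? G) a
                 in graphOf-adj (withoutOuter? G) (sym-adj i j a′ , λ o → ¬o (chord-sym o)))

    addOuter-nonCrossing : ∀ {G} → NonCrossing G → NonCrossing (addOuter G)
    addOuter-nonCrossing {G} nc a b c d ab cd a<c c<b b<d
      with adj-graphOf (withOuter? G) ab | adj-graphOf (withOuter? G) cd
    ... | inj₁ ab′ | inj₁ cd′ = nc a b c d ab′ cd′ a<c c<b b<d
    ... | inj₂ o   | _        = outer-uncrossed (inj₁ o) a<c c<b b<d
    ... | inj₁ _   | inj₂ o   = outer-uncrossed (inj₂ o) a<c c<b b<d

    edges-with-outer : ∀ {G k} → Adj G first last → HasEdges k (removeOuter G) → HasEdges (suc k) G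
    edges-with-outer {G} a hk =
      count-resp (λ p → [ (λ { refl → s≤s z≤n , a }) , (λ (lt , a′) → lt , removeOuter-⊆ G a′) ]′)
                 (λ (i , j) (lt , a′) → split i j lt a′)
                 (count-⊎ (count-single (first , last)) hk
                          (λ { _ refl (_ , a′) → proj₂ (adj-graphOf (withoutOuter? G) a′) outer-first-last }))
      where
      split : ∀ i j → toℕ i < toℕ j → Adj G i j → (i , j) ≡ (first , last) ⊎ (toℕ i < toℕ j × Adj (removeOuter G) i j)
      split i j i<j a′ with outer? i j
      ... | yes o = let (i≡f , j≡l) = firstLast-unique (chord-ordered (s≤s z≤n) i<j o) in inj₁ (cong₂ _,_ i≡f j≡l)
      ... | no ¬o = inj₂ (i<j , graphOf-adj (withoutOuter? G) (a′ , ¬o))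

    -- What remains of a connected non-crossing graph with k + 1 edges containing the
    -- chord {1, n} once that chord is deleted: either it is still connected, or it has
    -- exactly two components, one containing 1 and the other n.
    OuterDeleted : ℕ → Graph n → Set
    OuterDeleted k G = (ConnNC n k G × ¬ Adj G first last) ⊎ TwoCompNC n k G

    outerDeleted-ncGraph : ∀ {k G} → OuterDeleted k G → NCGraph k G
    outerDeleted-ncGraph (inj₁ ((g , _) , _)) = g
    outerDeleted-ncGraph (inj₂ (g , _))       = g

    outerDeleted-noOuter : ∀ {k G} → OuterDeleted k G → NoOuter G
    outerDeleted-noOuter {G = G} (inj₁ ((g , _) , ¬a))   = noOuter {G} (proj₁ g) ¬a
    outerDeleted-noOuter {G = G} (inj₂ (g , apart , _)) = noOuter {G} (proj₁ g) (λ a → apart first last firstLast (step a here))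

    -- Adding {1, n} gives a connected non-crossing graph with k + 1 edges containing {1, n}:
    -- in the two-component case every vertex reaches 1 or n, which are now adjacent.
    addOuter-connects : ∀ {k} G → OuterDeleted k G → ConnNCWithEdge n (suc k) (addOuter G)
    addOuter-connects {k} G od =
      ((simple⁺ , addOuter-nonCrossing {G} nc , edges⁺) , connected od) , atEnds (outerEdge first last outer-first-last)
      where
      g : NCGraph k G
      g = outerDeleted-ncGraph {k} {G} od
      nc : NonCrossing G
      nc = proj₁ (proj₂ g)
      simple⁺ : Simple (addOuter G)
      simple⁺ = addOuter-simple {G} (proj₁ g)
      outerEdge : ∀ i j → Outer i j → Adj (addOuter G) i j
      outerEdge i j o = graphOf-adj (withOuter? G) (inj₂ o)
      edges⁺ : HasEdges (suc k) (addOuter G)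
      edges⁺ = edges-with-outer {addOuter G} (outerEdge first last outer-first-last)
                 (subst (HasEdges k) (sym (removeOuter-addOuter G (outerDeleted-noOuter {k} {G} od))) (proj₂ (proj₂ g)))
      lift : ∀ {v w} → Reach G v w → Reach (addOuter G) v w
      lift = reach-mono (λ _ _ → addOuter-⊇ G)
      connected : OuterDeleted k G → Connected (addOuter G)
      connected (inj₁ ((_ , conn) , _)) i j = lift (conn i j)
      connected (inj₂ (_ , _ , cover)) = connected-via first (proj₂ simple⁺) λ v →
        [ lift , (λ r → reach-snoc (lift r) (outerEdge last first (chord-sym outer-first-last))) ]′ (cover v first last firstLast)

    reach-at : ∀ {H : Graph n} {v w} → toℕ v ≡ toℕ w → Reach H v w
    reach-at {H} v≡w = subst (Reach H _) (toℕ-injective v≡w) here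

    walk-split : ∀ G {v w} → Reach G v w →
                 Reach (removeOuter G) v w ⊎ (Reach (removeOuter G) v first ⊎ Reach (removeOuter G) v last)
    walk-split G here = inj₁ here
    walk-split G (step {i = v} {j = u} a r) with outer? v u
    ... | yes (inj₁ (v≡0 , _))   = inj₂ (inj₁ (reach-at v≡0))
    ... | yes (inj₂ (v≡n-1 , _)) = inj₂ (inj₂ (reach-at (trans v≡n-1 (sym (toℕ-fromℕ (suc m))))))
    ... | no ¬o = Sum.map prepend (Sum.map prepend prepend) (walk-split G r)
      where
      prepend : ∀ {w} → Reach (removeOuter G) u w → Reach (removeOuter G) v w
      prepend = step (graphOf-adj (withoutOuter? G) (a , ¬o))

    -- Conversely, deleting {1, n} leaves a graph in which every vertex still reaches 1 or n;
    -- if it is disconnected, 1 and n must lie in different components.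
    removeOuter-splits : ∀ {k} G → ConnNCWithEdge n (suc k) G → OuterDeleted k (removeOuter G)
    removeOuter-splits {k} G (((s , nc , edges) , conn) , hasOuter) = classify (connected? H)
      where
      H : Graph n
      H = removeOuter G
      symH : ∀ a b → Adj H a b → Adj H b a
      symH = proj₂ (removeOuter-simple {G} s)
      ncg : NCGraph k H
      ncg = removeOuter-simple {G} s , nonCrossing-⊆ {G = G} {H = H} (λ _ _ → removeOuter-⊆ G) nc ,
            subst (λ c → HasEdges c H)
                  (suc-injective (count-unique (edges-with-outer {G} (hasOuter first last firstLast) (hasEdges-edgeCount H)) edges))
                  (hasEdges-edgeCount H)
      toEnds : ∀ v → Reach H v first ⊎ Reach H v last
      toEnds v = [ inj₁ , (λ x → x) ]′ (walk-split G (conn v first))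
      classify : Dec (Connected H) → OuterDeleted k H
      classify (yes connH) = inj₁ ((ncg , connH) , λ a → proj₂ (adj-graphOf (withoutOuter? G) a) outer-first-last)
      classify (no ¬connH) = inj₂ (ncg , atEnds {λ i j → ¬ Reach H i j} apart , λ v → atEnds (toEnds v))
        where
        apart : ¬ Reach H first last
        apart r = ¬connH (connected-via first symH λ v →
                    [ (λ x → x) , (λ r′ → reach-trans r′ (reach-sym symH r)) ]′ (toEnds v))

    outer-both : ∀ {G} → Simple G → Adj G first last → ∀ i j → Outer i j → Adj G i j
    outer-both {G} s a i j (inj₁ ends) =
      subst₂ (Adj G) (sym (proj₁ (firstLast-unique ends))) (sym (proj₂ (firstLast-unique ends))) a
    outer-both {G} s a i j (inj₂ (i≡n-1 , j≡0)) = proj₂ s j i (outer-both {G} s a j i (inj₁ (j≡0 , i≡n-1)))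

    count-addOuter : ∀ {k a} → HasCount (OuterDeleted k) a → HasCount (ConnNCWithEdge n (suc k)) a
    count-addOuter {k} h = count-image (ConnNCWithEdge n (suc k)) addOuter h injective addOuter-connects onto
      where
      injective : ∀ G H → OuterDeleted k G → OuterDeleted k H → addOuter G ≡ addOuter H → G ≡ H
      injective G H odG odH e = begin
        G                         ≡⟨ sym (removeOuter-addOuter G (outerDeleted-noOuter {k} {G} odG)) ⟩
        removeOuter (addOuter G)  ≡⟨ cong removeOuter e ⟩
        removeOuter (addOuter H)  ≡⟨ removeOuter-addOuter H (outerDeleted-noOuter {k} {H} odH) ⟩
        H                         ∎
        where open ≡-Reasoning
      onto : ∀ G → ConnNCWithEdge n (suc k) G → ∃ λ H → OuterDeleted k H × addOuter H ≡ G
      onto G conn@(((s , _) , _) , hasOuter) =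
        removeOuter G , removeOuter-splits G conn ,
        addOuter-removeOuter G (outer-both {G} s (hasOuter first last firstLast))

    connNC? : ∀ k G → Dec (ConnNC n k G)
    connNC? k G = ncGraph? k G ×-dec connected? G

    hasOuter? : ∀ G → Dec (∀ i j → FirstLast n i j → Adj G i j)
    hasOuter? G = map′ atEnds (λ h → h first last firstLast) (adj? G first last)

    twoCompNC? : ∀ k G → Dec (TwoCompNC n k G)
    twoCompNC? k G =
      ncGraph? k G ×-dec
      map′ (atEnds {λ i j → ¬ Reach G i j}) (λ h → h first last firstLast) (¬? (reach? G first last)) ×-dec
      map′ (λ h v → atEnds (h v)) (λ h v → h v first last firstLast) (all? λ v → reach? G v first ⊎-dec reach? G v last)

    connNCWithEdge? : ∀ k G → Dec (ConnNCWithEdge n k G)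
    connNCWithEdge? k G = connNC? k G ×-dec hasOuter? G

    WithoutOuter : ℕ → Graph n → Set
    WithoutOuter k G = ConnNC n k G × ¬ Adj G first last

    withoutOuter-connNC? : ∀ k G → Dec (WithoutOuter k G)
    withoutOuter-connNC? k G = connNC? k G ×-dec ¬? (adj? G first last)

    -- The counting argument: splitting the connected graphs by the presence of {1, n} gives
    -- c_{n,k} = f_{n,k} + g, and the bijection count-addOuter gives f_{n,k+1} = g + d_{n,k}.
    count-identity : ∀ {k f f′ c d g} →
      HasCount (ConnNCWithEdge n k) f → HasCount (ConnNCWithEdge n (suc k)) f′ →
      HasCount (ConnNC n k) c → HasCount (TwoCompNC n k) d → HasCount (WithoutOuter k) g → f + f′ ≡ c + d
    count-identity {k} {f} {f′} {c} {d} {g} hf hf′ hc hd hg = begin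
      f + f′       ≡⟨ cong (f +_) (count-unique hf′ (count-addOuter (count-⊎ hg hd withoutOuter-twoComp-disjoint))) ⟩
      f + (g + d)  ≡⟨ sym (+-assoc f g d) ⟩
      (f + g) + d  ≡⟨ cong (_+ d) (count-unique hc′ hc) ⟩
      c + d        ∎
      where
      open ≡-Reasoning
      withoutOuter-twoComp-disjoint : ∀ G → WithoutOuter k G → TwoCompNC n k G → ⊥
      withoutOuter-twoComp-disjoint G ((_ , conn) , _) (_ , apart , _) = apart first last firstLast (conn first last)
      withOuter-disjoint : ∀ G → ConnNCWithEdge n k G → WithoutOuter k G → ⊥
      withOuter-disjoint G (_ , hasOuter) (_ , ¬a) = ¬a (hasOuter first last firstLast)
      hc′ : HasCount (ConnNC n k) (f + g)
      hc′ = count-resp (λ G → [ proj₁ , proj₁ ]′)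
                       (λ G cG → Sum.map (λ a → cG , atEnds a) (cG ,_) (toSum (adj? G first last)))
                       (count-⊎ hf hg withOuter-disjoint)

    edge-recurrence : ∀ k → ∃ λ f → ∃ λ f′ → ∃ λ c → ∃ λ d →
      HasCount (ConnNCWithEdge n k) f × HasCount (ConnNCWithEdge n (suc k)) f′ ×
      HasCount (ConnNC n k) c × HasCount (TwoCompNC n k) d × f + f′ ≡ c + d
    edge-recurrence k =
      let (f , hf) = count-graphs (connNCWithEdge? k)
          (f′ , hf′) = count-graphs (connNCWithEdge? (suc k))
          (c , hc) = count-graphs (connNC? k)
          (d , hd) = count-graphs (twoCompNC? k)
          (_ , hg) = count-graphs (withoutOuter-connNC? k)
      in f , f′ , c , d , hf , hf′ , hc , hd , count-identity hf hf′ hc hd hg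

module Catalan where

  open Counting using (sumBelow)
  open import Data.Nat using (ℕ; zero; suc; _+_; _*_; _∸_; _!)
  open import Data.Nat.Properties
  open import Data.Nat.Combinatorics using (_C_; k![n∸k]!∣n!)
  open import Data.Nat.Combinatorics.Specification using (nCk≡n!/k![n-k]!)
  open import Data.Nat.DivMod using (m/n*n≡m)
  open import Data.Nat.Tactic.RingSolver using (solve-∀)
  open import Relation.Binary.PropositionalEquality using (_≡_; refl; sym; trans; cong; cong₂; subst; subst₂; module ≡-Reasoning)
  open ≡-Reasoning

  -- catPow r k is the coefficient of x^k in C(x)^r, where C = 1 + x C² is the
  -- generating function of the Catalan numbers; the recursion is C^{r+1} = C^r + x C^{r+2}.
  catPow : ℕ → ℕ → ℕ
  catPow zero    zero    = 1
  catPow zero    (suc k) = 0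
  catPow (suc r) zero    = 1
  catPow (suc r) (suc k) = catPow r (suc k) + catPow (suc (suc r)) k

  Cat : ℕ → ℕ
  Cat = catPow 1

  -- Cauchy product of coefficient sequences: the coefficient of x^k in f · g.
  conv : (ℕ → ℕ) → (ℕ → ℕ) → ℕ → ℕ
  conv f g k = sumBelow (suc k) (λ i → f i * g (k ∸ i))

  conv-one : ∀ f k → conv f (catPow 0) k ≡ f k
  conv-one f zero    = trans (+-identityʳ _) (*-identityʳ (f 0))
  conv-one f (suc k) = trans (cong (_+ conv (λ i → f (suc i)) (catPow 0) k) (*-zeroʳ (f 0))) (conv-one (λ i → f (suc i)) k)

  conv-cong : ∀ f {g h} → (∀ j → g j ≡ h j) → ∀ k → conv f g k ≡ conv f h k
  conv-cong f g≗h zero    = cong (λ z → f 0 * z + 0) (g≗h 0)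
  conv-cong f g≗h (suc k) = cong₂ _+_ (cong (f 0 *_) (g≗h (suc k))) (conv-cong (λ i → f (suc i)) g≗h k)

  conv-+ : ∀ f g h k → conv f (λ j → g j + h j) k ≡ conv f g k + conv f h k
  conv-+ f g h zero = trans (cong (_+ 0) (*-distribˡ-+ (f 0) (g 0) (h 0))) (regroup (f 0 * g 0) (f 0 * h 0))
    where
    regroup : ∀ a b → a + b + 0 ≡ (a + 0) + (b + 0)
    regroup = solve-∀
  conv-+ f g h (suc k) = begin
    f 0 * (g (suc k) + h (suc k)) + conv f′ (λ j → g j + h j) k
      ≡⟨ cong₂ _+_ (*-distribˡ-+ (f 0) (g (suc k)) (h (suc k))) (conv-+ f′ g h k) ⟩
    (f 0 * g (suc k) + f 0 * h (suc k)) + (conv f′ g k + conv f′ h k)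
      ≡⟨ interchange (f 0 * g (suc k)) (f 0 * h (suc k)) (conv f′ g k) (conv f′ h k) ⟩
    (f 0 * g (suc k) + conv f′ g k) + (f 0 * h (suc k) + conv f′ h k) ∎
    where
    f′ : ℕ → ℕ
    f′ i = f (suc i)
    interchange : ∀ a b c d → (a + b) + (c + d) ≡ (a + c) + (b + d)
    interchange = solve-∀

  -- multiplication by x
  shift : (ℕ → ℕ) → ℕ → ℕ
  shift h zero    = 0
  shift h (suc j) = h j

  conv-shift : ∀ f h k → conv f (shift h) (suc k) ≡ conv f h k
  conv-shift f h zero    = cong (λ z → f 0 * h 0 + (z + 0)) (*-zeroʳ (f 1))
  conv-shift f h (suc k) = cong (f 0 * h (suc k) +_) (conv-shift (λ i → f (suc i)) h k)

  catPow-suc : ∀ r j → catPow (suc r) j ≡ catPow r j + shift (catPow (suc (suc r))) j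
  catPow-suc zero    zero    = refl
  catPow-suc (suc r) zero    = refl
  catPow-suc r       (suc j) = refl

  conv-catPow : ∀ r k → conv Cat (catPow r) k ≡ catPow (suc r) k
  conv-catPow zero    k       = conv-one Cat k
  conv-catPow (suc r) zero    = refl
  conv-catPow (suc r) (suc k) = begin
    conv Cat (catPow (suc r)) (suc k)
      ≡⟨ conv-cong Cat (catPow-suc r) (suc k) ⟩
    conv Cat (λ j → catPow r j + shift (catPow (suc (suc r))) j) (suc k)
      ≡⟨ conv-+ Cat (catPow r) (shift (catPow (suc (suc r)))) (suc k) ⟩
    conv Cat (catPow r) (suc k) + conv Cat (shift (catPow (suc (suc r)))) (suc k)
      ≡⟨ cong₂ _+_ (conv-catPow r (suc k)) (trans (conv-shift Cat (catPow (suc (suc r))) k) (conv-catPow (suc (suc r)) k)) ⟩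
    catPow (suc r) (suc k) + catPow (suc (suc (suc r))) k ∎

  segner : ∀ k → Cat (suc k) ≡ sumBelow (suc k) (λ i → Cat i * Cat (k ∸ i))
  segner k = sym (conv-catPow 1 k)

  private
    step-r1 : ∀ k X a B Y → X * (a * B) ≡ 2 * Y → X * ((suc k * a) * B) ≡ 1 * (suc (k + k + 1) * Y)
    step-r1 k X a B Y h = begin
      X * ((suc k * a) * B) ≡⟨ pull k X a B ⟩
      suc k * (X * (a * B)) ≡⟨ cong (suc k *_) h ⟩
      suc k * (2 * Y)       ≡⟨ double k Y ⟩
      1 * (suc (k + k + 1) * Y) ∎
      where
      pull : ∀ k X a B → X * ((suc k * a) * B) ≡ suc k * (X * (a * B))
      pull = solve-∀
      double : ∀ k Y → suc k * (2 * Y) ≡ 1 * (suc (k + k + 1) * Y)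
      double = solve-∀

    step-r≥2 : ∀ k s X₁ X₂ a W Y →
      X₁ * ((suc k * a) * (suc (k + suc s) * W)) ≡ suc s * Y →
      X₂ * (a * (suc (suc (k + suc s)) * (suc (k + suc s) * W))) ≡ suc (suc (suc s)) * Y →
      (X₁ + X₂) * ((suc k * a) * (suc (suc (k + suc s)) * (suc (k + suc s) * W))) ≡ suc (suc s) * (suc (suc k + suc k + s) * Y)
    step-r≥2 k s X₁ X₂ a W Y h₁ h₂ = begin
      (X₁ + X₂) * ((suc k * a) * (suc (suc (k + suc s)) * (suc (k + suc s) * W)))
        ≡⟨ distribute k s X₁ X₂ a W ⟩
      suc (suc (k + suc s)) * (X₁ * ((suc k * a) * (suc (k + suc s) * W))) + suc k * (X₂ * (a * (suc (suc (k + suc s)) * (suc (k + suc s) * W))))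
        ≡⟨ cong₂ (λ u v → suc (suc (k + suc s)) * u + suc k * v) h₁ h₂ ⟩
      suc (suc (k + suc s)) * (suc s * Y) + suc k * (suc (suc (suc s)) * Y)
        ≡⟨ collect k s Y ⟩
      suc (suc s) * (suc (suc k + suc k + s) * Y) ∎
      where
      distribute : ∀ k s X₁ X₂ a W → (X₁ + X₂) * ((suc k * a) * (suc (suc (k + suc s)) * (suc (k + suc s) * W)))
        ≡ suc (suc (k + suc s)) * (X₁ * ((suc k * a) * (suc (k + suc s) * W))) + suc k * (X₂ * (a * (suc (suc (k + suc s)) * (suc (k + suc s) * W))))
      distribute = solve-∀
      collect : ∀ k s Y → suc (suc (k + suc s)) * (suc s * Y) + suc k * (suc (suc (suc s)) * Y) ≡ suc (suc s) * (suc (suc k + suc k + s) * Y)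
      collect = solve-∀

  -- Closed form  catPow r k = r/(2k+r) · C(2k+r, k),  stated without division (r = s + 1).
  catPow-closed : ∀ s k → catPow (suc s) k * (k ! * (k + suc s) !) ≡ suc s * (k + k + s) !
  catPow-closed s zero = trans (*-identityˡ _) (*-identityˡ _)
  catPow-closed zero (suc k) = begin
    catPow 2 k * ((suc k * k !) * (suc k + 1) !)
      ≡⟨ cong (λ z → catPow 2 k * ((suc k * k !) * z)) (cong _! (sym (+-suc k 1))) ⟩
    catPow 2 k * ((suc k * k !) * (k + 2) !)
      ≡⟨ step-r1 k (catPow 2 k) (k !) ((k + 2) !) ((k + k + 1) !) (catPow-closed 1 k) ⟩
    1 * (suc (k + k + 1) * (k + k + 1) !)
      ≡⟨ cong (1 *_) (cong _! (reindex k)) ⟩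
    1 * (suc k + suc k + 0) ! ∎
    where
    reindex : ∀ k → suc (k + k + 1) ≡ suc k + suc k + 0
    reindex = solve-∀
  catPow-closed (suc s) (suc k) = begin
    (catPow (suc s) (suc k) + catPow (suc (suc (suc s))) k) * ((suc k * k !) * (suc k + suc (suc s)) !)
      ≡⟨ cong (λ z → (catPow (suc s) (suc k) + catPow (suc (suc (suc s))) k) * ((suc k * k !) * z)) expand₁ ⟩
    (catPow (suc s) (suc k) + catPow (suc (suc (suc s))) k) * ((suc k * k !) * (suc (suc (k + suc s)) * (suc (k + suc s) * (k + suc s) !)))
      ≡⟨ step-r≥2 k s (catPow (suc s) (suc k)) (catPow (suc (suc (suc s))) k) (k !) ((k + suc s) !) ((suc k + suc k + s) !)
                  (catPow-closed s (suc k)) ih₂ ⟩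
    suc (suc s) * (suc (suc k + suc k + s) * (suc k + suc k + s) !)
      ≡⟨ cong (suc (suc s) *_) (cong _! (sym (+-suc (suc k + suc k) s))) ⟩
    suc (suc s) * (suc k + suc k + suc s) ! ∎
    where
    expand₁ : (suc k + suc (suc s)) ! ≡ suc (suc (k + suc s)) * (suc (k + suc s) * (k + suc s) !)
    expand₁ = cong _! (cong suc (+-suc k (suc s)))
    expand₂ : (k + suc (suc (suc s))) ! ≡ suc (suc (k + suc s)) * (suc (k + suc s) * (k + suc s) !)
    expand₂ = cong _! (trans (+-suc k (suc (suc s))) (cong suc (+-suc k (suc s))))
    reindex : ∀ k s → k + k + suc (suc s) ≡ suc k + suc k + s
    reindex = solve-∀
    ih₂ : catPow (suc (suc (suc s))) k * (k ! * (suc (suc (k + suc s)) * (suc (k + suc s) * (k + suc s) !)))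
          ≡ suc (suc (suc s)) * (suc k + suc k + s) !
    ih₂ = subst₂ (λ u v → catPow (suc (suc (suc s))) k * (k ! * u) ≡ suc (suc (suc s)) * v)
                 expand₂ (cong _! (reindex k s)) (catPow-closed (suc (suc s)) k)

  central-binomial : ∀ k → ((k + k) C k) * (k ! * k !) ≡ (k + k) !
  central-binomial k = subst (λ z → ((k + k) C k) * (k ! * z !) ≡ (k + k) !) (m+n∸m≡n k k)
    (trans (cong (_* (k ! * (k + k ∸ k) !)) (nCk≡n!/k![n-k]! {k + k} {k} (m≤m+n k k)))
           (m/n*n≡m {{_}} (k![n∸k]!∣n! (m≤m+n k k))))

  catalan-closed : ∀ k → suc k * Cat k ≡ (k + k) C k
  catalan-closed k = *-cancelʳ-≡ (suc k * Cat k) ((k + k) C k) (k ! * k !) {{m*n≢0 (k !) (k !) {{k !≢0}} {{k !≢0}}}} (begin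
    suc k * Cat k * (k ! * k !)    ≡⟨ rearrange (suc k) (Cat k) (k !) ⟩
    Cat k * (k ! * (suc k * k !))  ≡⟨ cong (λ z → Cat k * (k ! * z)) (cong _! (sym (+-comm k 1))) ⟩
    Cat k * (k ! * (k + 1) !)      ≡⟨ catPow-closed 0 k ⟩
    1 * (k + k + 0) !              ≡⟨ trans (*-identityˡ _) (cong _! (+-identityʳ (k + k))) ⟩
    (k + k) !                      ≡⟨ sym (central-binomial k) ⟩
    ((k + k) C k) * (k ! * k !)    ∎)
    where
    rearrange : ∀ a b c → a * b * (c * c) ≡ b * (c * (a * c))
    rearrange = solve-∀

module Intervals where

  open import Defs
  open Counting
  open FiniteGraphs
  open import Data.Nat using (ℕ; zero; suc; _+_; _∸_; _≤_; _<_; s≤s; _≤?_; _<?_)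
  import Data.Nat as ℕ
  open import Data.Nat.Properties
  open import Data.Nat.Induction using (<-rec)
  open import Data.Nat.Tactic.RingSolver using (solve-∀)
  open import Data.Fin using (Fin; toℕ)
  open import Data.Fin.Properties using (toℕ-injective; any?)
  open import Data.List using (length; filter)
  open import Data.Product using (Σ; _×_; _,_; proj₁; proj₂)
  open import Data.Sum using (_⊎_; inj₁; inj₂; [_,_]′)
  open import Data.Empty using (⊥-elim)
  open import Relation.Nullary using (¬_; yes; no; Dec)
  open import Relation.Unary using (Decidable)
  open import Relation.Nullary.Decidable using (_×-dec_)
  open import Relation.Binary.PropositionalEquality using (_≡_; refl; sym; trans; cong; cong₂; subst; subst₂; module ≡-Reasoning)

  sum-tight : ∀ {x y A B} → x ≤ A → y ≤ B → x + y ≡ A + B → x ≡ A × y ≡ B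
  sum-tight {x} {y} {A} {B} x≤A y≤B sum≡ = x≡A , +-cancelˡ-≡ x y B (trans sum≡ (cong (_+ B) (sym x≡A)))
    where
    x≡A : x ≡ A
    x≡A = ≤-antisym x≤A (+-cancelʳ-≤ y A x (subst (A + y ≤_) (sym sum≡) (+-monoʳ-≤ A y≤B)))

  lastBelow : ∀ {Q : ℕ → Set} → (∀ j → Dec (Q j)) → ∀ b →
    (Σ ℕ λ j → j < b × Q j × (∀ j′ → j < j′ → j′ < b → ¬ Q j′)) ⊎ (∀ j → j < b → ¬ Q j)
  lastBelow Q? zero = inj₂ (λ j j<0 → ⊥-elim (n≮0 j<0))
  lastBelow Q? (suc b) with Q? b
  ... | yes q = inj₁ (b , ≤-refl , q , (λ j′ b<j′ j′<1+b → ⊥-elim (<-irrefl refl (≤-trans (s≤s b<j′) j′<1+b))))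
  ... | no ¬q with lastBelow Q? b
  ...   | inj₁ (j , j<b , q , largest) = inj₁ (j , m≤n⇒m≤1+n j<b , q ,
            (λ j′ j<j′ j′<1+b q′ → [ (λ j′<b → largest j′ j<j′ j′<b q′) , (λ { refl → ¬q q′ }) ]′ (m≤n⇒m<n∨m≡n (≤-pred j′<1+b))))
  ...   | inj₂ none = inj₂ (λ j j<1+b q → [ (λ j<b → none j j<b q) , (λ { refl → ¬q q }) ]′ (m≤n⇒m<n∨m≡n (≤-pred j<1+b)))

  ends-meet : ∀ a j d → j ≤ d → a + suc j + suc (d ∸ j) ≡ a + suc (suc d)
  ends-meet a j d j≤d = trans (shape a j (d ∸ j)) (cong (λ z → a + suc (suc z)) (m+[n∸m]≡n j≤d))
    where
    shape : ∀ a j f → a + suc j + suc f ≡ a + suc (suc (j + f))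
    shape = solve-∀

  sides-add-up : ∀ e f → suc (e + e) + suc (f + f) + 1 ≡ suc (suc (e + f) + suc (e + f))
  sides-add-up = solve-∀

  module _ {n : ℕ} where

    InInterval : ℕ → ℕ → Fin n × Fin n → Set
    InInterval a b (i , j) = a ≤ toℕ i × toℕ i < toℕ j × toℕ j ≤ b

    EdgeIn : Graph n → ℕ → ℕ → Fin n × Fin n → Set
    EdgeIn G a b p = InInterval a b p × Adj G (proj₁ p) (proj₂ p)

    edgeIn? : ∀ G a b → Decidable (EdgeIn G a b)
    edgeIn? G a b (i , j) = ((a ≤? toℕ i) ×-dec (toℕ i <? toℕ j) ×-dec (toℕ j ≤? b)) ×-dec adj? G i j

    edgesIn : Graph n → ℕ → ℕ → ℕ
    edgesIn G a b = length (filter (edgeIn? G a b) allPairs)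

    count-edgesIn : ∀ G a b → HasCount (EdgeIn G a b) (edgesIn G a b)
    count-edgesIn G a b = count-pairs (edgeIn? G a b)

    ChordEdge : Graph n → ℕ → ℕ → Fin n × Fin n → Set
    ChordEdge G a b (i , j) = toℕ i ≡ a × toℕ j ≡ b × Adj G i j

    chordEdges : Graph n → ℕ → ℕ → ℕ
    chordEdges G a b = length (filter (λ (i , j) → (toℕ i ℕ.≟ a) ×-dec (toℕ j ℕ.≟ b) ×-dec adj? G i j) allPairs)

    count-chordEdges : ∀ G a b → HasCount (ChordEdge G a b) (chordEdges G a b)
    count-chordEdges G a b = count-pairs _

    chordEdges≤1 : ∀ G a b → chordEdges G a b ≤ 1
    chordEdges≤1 G a b = count-≤1 (count-chordEdges G a b)
      (λ { (i , j) (i′ , j′) (i≡a , j≡b , _) (i′≡a , j′≡b , _) →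
           cong₂ _,_ (toℕ-injective (trans i≡a (sym i′≡a))) (toℕ-injective (trans j≡b (sym j′≡b))) })

    Splits : Graph n → ℕ → ℕ → ℕ → Set
    Splits G a b m = a < m × m < b ×
      (∀ i j → Adj G i j → a ≤ toℕ i → toℕ i < m → m < toℕ j → toℕ j ≤ b → toℕ i ≡ a × toℕ j ≡ b)

    edgesIn-split : ∀ G a b m → Splits G a b m → edgesIn G a b ≡ edgesIn G a m + edgesIn G m b + chordEdges G a b
    edgesIn-split G a b m (a<m , m<b , jump) = count-unique (count-edgesIn G a b)
      (count-resp (λ p → [ [ (λ { ((a≤i , i<j , j≤m) , e) → (a≤i , i<j , ≤-trans j≤m (<⇒≤ m<b)) , e })
                           , (λ { ((m≤i , i<j , j≤b) , e) → (≤-trans (<⇒≤ a<m) m≤i , i<j , j≤b) , e }) ]′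
                         , (λ { (i≡a , j≡b , e) → (≤-reflexive (sym i≡a) , subst₂ _<_ (sym i≡a) (sym j≡b) (<-trans a<m m<b) , ≤-reflexive j≡b) , e }) ]′)
                  (λ { (i , j) ((a≤i , i<j , j≤b) , e) → classify i j a≤i i<j j≤b e })
                  (count-⊎ (count-⊎ (count-edgesIn G a m) (count-edgesIn G m b)
                                    (λ { (i , j) ((_ , i<j , j≤m) , _) ((m≤i , _ , _) , _) → <-irrefl refl (<-≤-trans i<j (≤-trans j≤m m≤i)) }))
                           (count-chordEdges G a b)
                           (λ { (i , j) (inj₁ ((_ , _ , j≤m) , _)) (_ , j≡b , _) → <-irrefl refl (≤-<-trans (subst (_≤ m) j≡b j≤m) m<b)
                              ; (i , j) (inj₂ ((m≤i , _ , _) , _)) (i≡a , _ , _) → <-irrefl refl (<-≤-trans a<m (subst (m ≤_) i≡a m≤i)) })))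
      where
      classify : ∀ i j → a ≤ toℕ i → toℕ i < toℕ j → toℕ j ≤ b → Adj G i j →
                 (EdgeIn G a m (i , j) ⊎ EdgeIn G m b (i , j)) ⊎ ChordEdge G a b (i , j)
      classify i j a≤i i<j j≤b e with toℕ j ≤? m
      ... | yes j≤m = inj₁ (inj₁ ((a≤i , i<j , j≤m) , e))
      ... | no  j≰m with m ≤? toℕ i
      ...   | yes m≤i = inj₁ (inj₂ ((m≤i , i<j , j≤b) , e))
      ...   | no  m≰i = let (i≡a , j≡b) = jump i j e a≤i (≰⇒> m≰i) (≰⇒> j≰m) j≤b in inj₂ (i≡a , j≡b , e)

    EdgeFrom : Graph n → ℕ → ℕ → Set
    EdgeFrom G a j = a < j × Σ (Fin n) λ x → Σ (Fin n) λ y → toℕ x ≡ a × toℕ y ≡ j × Adj G x y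

    edgeFrom? : ∀ G a j → Dec (EdgeFrom G a j)
    edgeFrom? G a j with a <? j | any? (λ x → any? (λ y → (toℕ x ℕ.≟ a) ×-dec (toℕ y ℕ.≟ j) ×-dec adj? G x y))
    ... | no a≮j  | _              = no (λ q → a≮j (proj₁ q))
    ... | yes a<j | yes (x , y , e) = yes (a<j , x , y , e)
    ... | yes a<j | no none        = no (λ { (_ , x , y , e) → none (x , y , e) })

    -- In a non-crossing graph every interval a … b with b ≥ a + 2 has a splitting position:
    -- the far end of the last edge leaving a inside the interval, or a + 1 if there is none.
    split-exists : ∀ G → NonCrossing G → ∀ a b → suc a < b → Σ ℕ (Splits G a b)
    split-exists G nc a b a+1<b with lastBelow (edgeFrom? G a) b
    ... | inj₁ (m , m<b , (a<m , x , y , x≡a , y≡m , xy) , largest) = m , a<m , m<b , jump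
      where
      jump : ∀ i j → Adj G i j → a ≤ toℕ i → toℕ i < m → m < toℕ j → toℕ j ≤ b → toℕ i ≡ a × toℕ j ≡ b
      jump i j e a≤i i<m m<j j≤b with toℕ i ℕ.≟ a
      ... | yes i≡a = i≡a , ≤∧≮⇒≡ j≤b (λ j<b → largest (toℕ j) m<j j<b (≤-<-trans a≤i (<-trans i<m m<j) , i , j , i≡a , refl , e))
      ... | no  i≢a = ⊥-elim (nc x y i j xy e (subst (_< toℕ i) (sym x≡a) (≤∧≢⇒< a≤i (λ a≡i → i≢a (sym a≡i))))
                                  (subst (toℕ i <_) (sym y≡m) i<m) (subst (_< toℕ j) (sym y≡m) m<j))
    ... | inj₂ none = suc a , ≤-refl , a+1<b , jump
      where
      jump : ∀ i j → Adj G i j → a ≤ toℕ i → toℕ i < suc a → suc a < toℕ j → toℕ j ≤ b → toℕ i ≡ a × toℕ j ≡ b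
      jump i j e a≤i i<a+1 a+1<j j≤b =
        i≡a , ≤∧≮⇒≡ j≤b (λ j<b → none (toℕ j) j<b (<-trans ≤-refl a+1<j , i , j , i≡a , refl , e))
        where i≡a = ≤-antisym (≤-pred i<a+1) a≤i

    record Split (G : Graph n) (a d : ℕ) : Set where
      field
        e : ℕ
        e≤d : e ≤ d
        splits : Splits G a (a + suc (suc d)) (a + suc e)

      m f : ℕ
      m = a + suc e
      f = d ∸ e

      f≤d : f ≤ d
      f≤d = m∸n≤m d e

      d≡ : d ≡ e + f
      d≡ = sym (m+[n∸m]≡n e≤d)

      b≡ : a + suc (suc d) ≡ m + suc f
      b≡ = sym (ends-meet a e d e≤d)

    split : ∀ G → NonCrossing G → ∀ a d → Split G a d
    split G nc a d with split-exists G nc a (a + suc (suc d)) a+1<b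
      where
      a+1<b : suc a < a + suc (suc d)
      a+1<b = subst (suc (suc a) ≤_) (shape a d) (s≤s (s≤s (m≤m+n a d)))
        where
        shape : ∀ a d → suc (suc (a + d)) ≡ a + suc (suc d)
        shape = solve-∀
    ... | m , splits with gap (proj₁ splits)
      where
      gap : ∀ {x y} → x < y → Σ ℕ λ g → y ≡ x + suc g
      gap {zero}  {suc y} _         = y , refl
      gap {suc x} {suc y} (s≤s x<y) = let (g , eq) = gap x<y in g , cong suc eq
    ... | e , refl = record { e = e ; e≤d = ≤-pred (≤-pred (+-cancelˡ-< a _ _ (proj₁ (proj₂ splits)))) ; splits = splits }

    unit-interval : ∀ G a p → EdgeIn G a (a + 1) p → ChordEdge G a (a + 1) p
    unit-interval G a (i , j) ((a≤i , i<j , j≤a+1) , e) = i≡a , j≡a+1 , e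
      where
      j≤1+a : toℕ j ≤ suc a
      j≤1+a = subst (toℕ j ≤_) (+-comm a 1) j≤a+1
      i≡a : toℕ i ≡ a
      i≡a = ≤-antisym (≤-pred (<-≤-trans i<j j≤1+a)) a≤i
      j≡a+1 : toℕ j ≡ a + 1
      j≡a+1 = trans (≤-antisym j≤1+a (subst (_< toℕ j) i≡a i<j)) (+-comm 1 a)

    edgesIn-bound : ∀ G → NonCrossing G → ∀ d a → edgesIn G a (a + suc d) ≤ suc (d + d)
    edgesIn-bound G nc = <-rec _ bound
      where
      bound : ∀ d → (∀ {e} → e < d → ∀ a → edgesIn G a (a + suc e) ≤ suc (e + e)) →
              ∀ a → edgesIn G a (a + suc d) ≤ suc (d + d)
      bound zero _ a =
        ≤-trans (count-≤ (count-edgesIn G a (a + 1)) (count-chordEdges G a (a + 1)) (unit-interval G a))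
                (chordEdges≤1 G a (a + 1))
      bound (suc d) rec a = begin
        edgesIn G a (a + suc (suc d))
          ≡⟨ edgesIn-split G a _ m splits ⟩
        edgesIn G a m + edgesIn G m (a + suc (suc d)) + chordEdges G a (a + suc (suc d))
          ≡⟨ cong (λ y → edgesIn G a m + edgesIn G m y + chordEdges G a (a + suc (suc d))) b≡ ⟩
        edgesIn G a m + edgesIn G m (m + suc f) + chordEdges G a (a + suc (suc d))
          ≤⟨ +-mono-≤ (+-mono-≤ (rec (s≤s e≤d) a) (rec (s≤s f≤d) m)) (chordEdges≤1 G a _) ⟩
        suc (e + e) + suc (f + f) + 1
          ≡⟨ sides-add-up e f ⟩
        suc (suc (e + f) + suc (e + f))
          ≡⟨ cong (λ z → suc (suc z + suc z)) (sym d≡) ⟩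
        suc (suc d + suc d) ∎
        where
        open ≤-Reasoning
        open Split (split G nc a d)

    Saturated : Graph n → ℕ → ℕ → Set
    Saturated G a d = edgesIn G a (a + suc d) ≡ suc (d + d)

    saturated-split : ∀ G → NonCrossing G → ∀ a d → Saturated G a (suc d) → (sp : Split G a d) →
      let open Split sp in Saturated G a e × Saturated G m f × chordEdges G a (a + suc (suc d)) ≡ 1
    saturated-split G nc a d full sp =
      let (left+right , chord) = sum-tight (+-mono-≤ left≤ right≤) (chordEdges≤1 G a _) total
          (left , right) = sum-tight left≤ right≤ left+right
      in left , right , chord
      where
      open Split sp
      left≤ : edgesIn G a m ≤ suc (e + e)
      left≤ = edgesIn-bound G nc e a
      right≤ : edgesIn G m (m + suc f) ≤ suc (f + f)
      right≤ = edgesIn-bound G nc f m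
      total : edgesIn G a m + edgesIn G m (m + suc f) + chordEdges G a (a + suc (suc d))
              ≡ suc (e + e) + suc (f + f) + 1
      total = begin
        edgesIn G a m + edgesIn G m (m + suc f) + chordEdges G a (a + suc (suc d))
          ≡⟨ cong (λ y → edgesIn G a m + edgesIn G m y + chordEdges G a (a + suc (suc d))) (sym b≡) ⟩
        edgesIn G a m + edgesIn G m (a + suc (suc d)) + chordEdges G a (a + suc (suc d))
          ≡⟨ sym (edgesIn-split G a _ m splits) ⟩
        edgesIn G a (a + suc (suc d))
          ≡⟨ full ⟩
        suc (suc d + suc d)
          ≡⟨ cong (λ z → suc (suc z + suc z)) d≡ ⟩
        suc (suc (e + f) + suc (e + f))
          ≡⟨ sym (sides-add-up e f) ⟩
        suc (e + e) + suc (f + f) + 1 ∎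
        where open ≡-Reasoning

    saturated-chord : ∀ G → NonCrossing G → ∀ a d → Saturated G a d → Σ (Fin n × Fin n) (ChordEdge G a (a + suc d))
    saturated-chord G nc a zero full = count-witness (subst (HasCount _) one (count-chordEdges G a (a + 1)))
      where
      one : chordEdges G a (a + 1) ≡ 1
      one = ≤-antisym (chordEdges≤1 G a (a + 1))
        (subst (_≤ chordEdges G a (a + 1)) full
          (count-≤ (count-edgesIn G a (a + 1)) (count-chordEdges G a (a + 1)) (unit-interval G a)))
    saturated-chord G nc a (suc d) full =
      count-witness (subst (HasCount _) (proj₂ (proj₂ (saturated-split G nc a d full (split G nc a d))))
                           (count-chordEdges G a (a + suc (suc d))))

module Triangulations where

  open import Defs
  open Counting
  open FiniteGraphs
  open Intervals
  open Catalan using (Cat; segner)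
  open import Data.Nat using (ℕ; zero; suc; _+_; _*_; _∸_; _≤_; _<_; s≤s; z<s; _≤?_)
  open import Data.Nat.Properties
  open import Data.Nat.Induction using (<-rec)
  open import Data.Fin using (Fin; toℕ; fromℕ<)
  open import Data.Fin.Properties using (toℕ-injective; toℕ-fromℕ<)
  open import Data.Product using (Σ; _×_; _,_; proj₁; proj₂)
  import Data.Product as Product
  open import Data.Sum using (_⊎_; inj₁; inj₂)
  import Data.Sum as Sum
  open import Data.Empty using (⊥; ⊥-elim)
  open import Relation.Nullary using (¬_; yes; no; Dec)
  open import Relation.Nullary.Decidable using (_×-dec_; _⊎-dec_)
  open import Relation.Binary.Definitions using (tri<; tri≈; tri>)
  open import Relation.Binary.PropositionalEquality using (_≡_; refl; sym; trans; cong; cong₂; subst; subst₂; module ≡-Reasoning)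

  module _ {n : ℕ} where

    InRange : ℕ → ℕ → Fin n → Set
    InRange a b x = a ≤ toℕ x × toℕ x ≤ b

    restrict? : ∀ a b (G : Graph n) x y → Dec (Adj G x y × InRange a b x × InRange a b y)
    restrict? a b G x y = adj? G x y ×-dec ((a ≤? toℕ x) ×-dec (toℕ x ≤? b)) ×-dec ((a ≤? toℕ y) ×-dec (toℕ y ≤? b))

    restrict : ℕ → ℕ → Graph n → Graph n
    restrict a b G = graphOf (restrict? a b G)

    restrict-adj : ∀ a b G {x y} → Adj (restrict a b G) x y → Adj G x y × InRange a b x × InRange a b y
    restrict-adj a b G = adj-graphOf (restrict? a b G)

    adj-restrict : ∀ a b G {x y} → Adj G x y → InRange a b x → InRange a b y → Adj (restrict a b G) x y
    adj-restrict a b G e x∈ y∈ = graphOf-adj (restrict? a b G) (e , x∈ , y∈)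

    restrict-⊆ : ∀ a b G x y → Adj (restrict a b G) x y → Adj G x y
    restrict-⊆ a b G x y e = proj₁ (restrict-adj a b G e)

    restrict-simple : ∀ a b G → Simple G → Simple (restrict a b G)
    restrict-simple a b G (irr , sym-adj) =
      (λ i e → irr i (restrict-⊆ a b G i i e)) ,
      (λ i j e → let (e′ , i∈ , j∈) = restrict-adj a b G e in adj-restrict a b G (sym-adj i j e′) j∈ i∈)

    edgesIn-restrict : ∀ G a b → edgesIn (restrict a b G) a b ≡ edgesIn G a b
    edgesIn-restrict G a b = count-unique (count-edgesIn (restrict a b G) a b)
      (count-resp (λ { (x , y) ((a≤x , x<y , y≤b) , e) →
                        (a≤x , x<y , y≤b) , adj-restrict a b G e (a≤x , ≤-trans (<⇒≤ x<y) y≤b) (≤-trans a≤x (<⇒≤ x<y) , y≤b) })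
                  (λ { (x , y) (range , e) → range , restrict-⊆ a b G x y e })
                  (count-edgesIn G a b))

    Within : ℕ → ℕ → Graph n → Set
    Within a b G = ∀ i j → Adj G i j → InRange a b i

    within-both : ∀ {a b} G → Simple G → Within a b G → ∀ i j → Adj G i j → InRange a b i × InRange a b j
    within-both G s w i j e = w i j e , w j i (proj₂ s i j e)

    glue? : ∀ a b (h₁ h₂ : Graph n) x y → Dec (Adj h₁ x y ⊎ Adj h₂ x y ⊎ Chord a b x y)
    glue? a b h₁ h₂ x y = adj? h₁ x y ⊎-dec adj? h₂ x y ⊎-dec chord? a b x y

    glue : ℕ → ℕ → Graph n → Graph n → Graph n
    glue a b h₁ h₂ = graphOf (glue? a b h₁ h₂)

    glue-adj : ∀ a b h₁ h₂ {x y} → Adj (glue a b h₁ h₂) x y → Adj h₁ x y ⊎ Adj h₂ x y ⊎ Chord a b x y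
    glue-adj a b h₁ h₂ = adj-graphOf (glue? a b h₁ h₂)

    adj-glue : ∀ a b h₁ h₂ {x y} → Adj h₁ x y ⊎ Adj h₂ x y ⊎ Chord a b x y → Adj (glue a b h₁ h₂) x y
    adj-glue a b h₁ h₂ = graphOf-adj (glue? a b h₁ h₂)

    -- A triangulation of the polygon with vertices a … a + d + 1: a simple non-crossing
    -- graph living there with the maximal number 2d + 1 of edges.
    Tri : ℕ → ℕ → Graph n → Set
    Tri a d G = Simple G × NonCrossing G × Within a (a + suc d) G × Saturated G a d

    record Adjacent (a m b : ℕ) (h₁ h₂ : Graph n) : Set where
      field
        simple₁ : Simple h₁
        nc₁ : NonCrossing h₁
        within₁ : Within a m h₁
        simple₂ : Simple h₂
        nc₂ : NonCrossing h₂
        within₂ : Within m b h₂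
        a<m : a < m
        m<b : m < b

    module Glued {a m b h₁ h₂} (adjacent : Adjacent a m b h₁ h₂) where
      open Adjacent adjacent

      G : Graph n
      G = glue a b h₁ h₂

      range₁ : ∀ i j → Adj h₁ i j → InRange a m i × InRange a m j
      range₁ = within-both h₁ simple₁ within₁

      range₂ : ∀ i j → Adj h₂ i j → InRange m b i × InRange m b j
      range₂ = within-both h₂ simple₂ within₂

      chord-range : ∀ {x y} → Chord a b x y → InRange a b x × InRange a b y
      chord-range (inj₁ (x≡a , y≡b)) = (≤-reflexive (sym x≡a) , subst (_≤ b) (sym x≡a) (<⇒≤ (<-trans a<m m<b))) ,
                                       (subst (a ≤_) (sym y≡b) (<⇒≤ (<-trans a<m m<b)) , ≤-reflexive y≡b)
      chord-range (inj₂ (x≡b , y≡a)) = let (y∈ , x∈) = chord-range (inj₁ (y≡a , x≡b)) in x∈ , y∈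

      range : ∀ x y → Adj G x y → InRange a b x × InRange a b y
      range x y e with glue-adj a b h₁ h₂ e
      ... | inj₁ e₁ = let ((a≤x , x≤m) , (a≤y , y≤m)) = range₁ x y e₁
                      in (a≤x , ≤-trans x≤m (<⇒≤ m<b)) , (a≤y , ≤-trans y≤m (<⇒≤ m<b))
      ... | inj₂ (inj₁ e₂) = let ((m≤x , x≤b) , (m≤y , y≤b)) = range₂ x y e₂
                             in (≤-trans (<⇒≤ a<m) m≤x , x≤b) , (≤-trans (<⇒≤ a<m) m≤y , y≤b)
      ... | inj₂ (inj₂ c) = chord-range c

      within : Within a b G
      within i j e = proj₁ (range i j e)

      simple : Simple G
      simple = (λ i e → loopless i (glue-adj a b h₁ h₂ e)) ,
               (λ i j e → adj-glue a b h₁ h₂ (Sum.map (proj₂ simple₁ i j) (Sum.map (proj₂ simple₂ i j) chord-sym)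
                                                (glue-adj a b h₁ h₂ e)))
        where
        loopless : ∀ i → ¬ (Adj h₁ i i ⊎ Adj h₂ i i ⊎ Chord a b i i)
        loopless i (inj₁ e) = proj₁ simple₁ i e
        loopless i (inj₂ (inj₁ e)) = proj₁ simple₂ i e
        loopless i (inj₂ (inj₂ (inj₁ (i≡a , i≡b)))) = <-irrefl (trans (sym i≡a) i≡b) (<-trans a<m m<b)
        loopless i (inj₂ (inj₂ (inj₂ (i≡b , i≡a)))) = <-irrefl (trans (sym i≡a) i≡b) (<-trans a<m m<b)

      -- Chords of the two sides cannot cross, as they live on intervals meeting only in m,
      -- and nothing crosses the chord (a, b) bounding the whole interval.
      nonCrossing : NonCrossing G
      nonCrossing w x y z e₁ e₂ w<y y<x x<z = cross (glue-adj a b h₁ h₂ e₁) (glue-adj a b h₁ h₂ e₂)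
        where
        a≤w : a ≤ toℕ w
        a≤w = proj₁ (proj₁ (range w x e₁))
        x≤b : toℕ x ≤ b
        x≤b = proj₂ (proj₂ (range w x e₁))
        a≤y : a ≤ toℕ y
        a≤y = proj₁ (proj₁ (range y z e₂))
        z≤b : toℕ z ≤ b
        z≤b = proj₂ (proj₂ (range y z e₂))
        cross : Adj h₁ w x ⊎ Adj h₂ w x ⊎ Chord a b w x → Adj h₁ y z ⊎ Adj h₂ y z ⊎ Chord a b y z → ⊥
        cross (inj₂ (inj₂ (inj₁ (_ , x≡b)))) _ = <-irrefl refl (≤-<-trans z≤b (subst (_< toℕ z) x≡b x<z))
        cross (inj₂ (inj₂ (inj₂ (_ , x≡a)))) _ = <-irrefl refl (≤-<-trans a≤y (subst (toℕ y <_) x≡a y<x))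
        cross _ (inj₂ (inj₂ (inj₁ (y≡a , _)))) = <-irrefl refl (≤-<-trans a≤w (subst (toℕ w <_) y≡a w<y))
        cross _ (inj₂ (inj₂ (inj₂ (y≡b , _)))) = <-irrefl refl (≤-<-trans x≤b (subst (_< toℕ x) y≡b y<x))
        cross (inj₁ p) (inj₁ q) = nc₁ w x y z p q w<y y<x x<z
        cross (inj₂ (inj₁ p)) (inj₂ (inj₁ q)) = nc₂ w x y z p q w<y y<x x<z
        cross (inj₁ p) (inj₂ (inj₁ q)) =
          <-irrefl refl (<-≤-trans y<x (≤-trans (proj₂ (proj₂ (range₁ w x p))) (proj₁ (proj₁ (range₂ y z q)))))
        cross (inj₂ (inj₁ p)) (inj₁ q) =
          <-irrefl refl (<-≤-trans w<y (≤-trans (proj₂ (proj₁ (range₁ y z q))) (proj₁ (proj₁ (range₂ w x p)))))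

      restrict-glue₁ : restrict a m G ≡ h₁
      restrict-glue₁ = graph-ext to (λ x y e → let (x∈ , y∈) = range₁ x y e in adj-restrict a m G (adj-glue a b h₁ h₂ (inj₁ e)) x∈ y∈)
        where
        to : ∀ x y → Adj (restrict a m G) x y → Adj h₁ x y
        to x y e with restrict-adj a m G e
        ... | e′ , (_ , x≤m) , (_ , y≤m) with glue-adj a b h₁ h₂ e′
        ...   | inj₁ e₁ = e₁
        ...   | inj₂ (inj₁ e₂) = ⊥-elim (proj₁ simple₂ x (subst (Adj h₂ x) (sym x≡y) e₂))
          where
          x≡y : x ≡ y
          x≡y = toℕ-injective (trans (≤-antisym x≤m (proj₁ (proj₁ (range₂ x y e₂))))
                                     (sym (≤-antisym y≤m (proj₁ (proj₂ (range₂ x y e₂))))))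
        ...   | inj₂ (inj₂ (inj₁ (_ , y≡b))) = ⊥-elim (<-irrefl refl (<-≤-trans m<b (subst (_≤ m) y≡b y≤m)))
        ...   | inj₂ (inj₂ (inj₂ (x≡b , _))) = ⊥-elim (<-irrefl refl (<-≤-trans m<b (subst (_≤ m) x≡b x≤m)))

      restrict-glue₂ : restrict m b G ≡ h₂
      restrict-glue₂ = graph-ext to (λ x y e → let (x∈ , y∈) = range₂ x y e in adj-restrict m b G (adj-glue a b h₁ h₂ (inj₂ (inj₁ e))) x∈ y∈)
        where
        to : ∀ x y → Adj (restrict m b G) x y → Adj h₂ x y
        to x y e with restrict-adj m b G e
        ... | e′ , (m≤x , _) , (m≤y , _) with glue-adj a b h₁ h₂ e′
        ...   | inj₂ (inj₁ e₂) = e₂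
        ...   | inj₁ e₁ = ⊥-elim (proj₁ simple₁ x (subst (Adj h₁ x) (sym x≡y) e₁))
          where
          x≡y : x ≡ y
          x≡y = toℕ-injective (trans (≤-antisym (proj₂ (proj₁ (range₁ x y e₁))) m≤x)
                                     (sym (≤-antisym (proj₂ (proj₂ (range₁ x y e₁))) m≤y)))
        ...   | inj₂ (inj₂ (inj₁ (x≡a , _))) = ⊥-elim (<-irrefl refl (<-≤-trans a<m (subst (m ≤_) x≡a m≤x)))
        ...   | inj₂ (inj₂ (inj₂ (_ , y≡a))) = ⊥-elim (<-irrefl refl (<-≤-trans a<m (subst (m ≤_) y≡a m≤y)))

      glue-splits : Splits G a b m
      glue-splits = a<m , m<b , jump
        where
        jump : ∀ i j → Adj G i j → a ≤ toℕ i → toℕ i < m → m < toℕ j → toℕ j ≤ b → toℕ i ≡ a × toℕ j ≡ b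
        jump i j e _ i<m m<j _ with glue-adj a b h₁ h₂ e
        ... | inj₁ e₁ = ⊥-elim (<-irrefl refl (<-≤-trans m<j (proj₂ (proj₂ (range₁ i j e₁)))))
        ... | inj₂ (inj₁ e₂) = ⊥-elim (<-irrefl refl (<-≤-trans i<m (proj₁ (proj₁ (range₂ i j e₂)))))
        ... | inj₂ (inj₂ c) = chord-ordered (<-trans a<m m<b) (<-trans i<m m<j) c

      edgesIn-glue : (ends : Fin n × Fin n) → toℕ (proj₁ ends) ≡ a → toℕ (proj₂ ends) ≡ b →
                     edgesIn G a b ≡ edgesIn h₁ a m + edgesIn h₂ m b + 1
      edgesIn-glue (x , y) x≡a y≡b = begin
        edgesIn G a b                                                  ≡⟨ edgesIn-split G a b m glue-splits ⟩
        edgesIn G a m + edgesIn G m b + chordEdges G a b               ≡⟨ cong₂ (λ u v → u + v + chordEdges G a b) (side₁) (side₂) ⟩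
        edgesIn h₁ a m + edgesIn h₂ m b + chordEdges G a b             ≡⟨ cong (edgesIn h₁ a m + edgesIn h₂ m b +_) oneChord ⟩
        edgesIn h₁ a m + edgesIn h₂ m b + 1                            ∎
        where
        open ≡-Reasoning
        side₁ : edgesIn G a m ≡ edgesIn h₁ a m
        side₁ = trans (sym (edgesIn-restrict G a m)) (cong (λ H → edgesIn H a m) restrict-glue₁)
        side₂ : edgesIn G m b ≡ edgesIn h₂ m b
        side₂ = trans (sym (edgesIn-restrict G m b)) (cong (λ H → edgesIn H m b) restrict-glue₂)
        oneChord : chordEdges G a b ≡ 1
        oneChord = ≤-antisym (chordEdges≤1 G a b)
          (count-≤ (count-single (x , y)) (count-chordEdges G a b)
                   (λ { _ refl → x≡a , y≡b , adj-glue a b h₁ h₂ (inj₂ (inj₂ (inj₁ (x≡a , y≡b)))) }))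

    restrict-tri : ∀ G a e → Simple G → NonCrossing G → Saturated G a e → Tri a e (restrict a (a + suc e) G)
    restrict-tri G a e s nc full =
      restrict-simple a b G s , nonCrossing-⊆ {G = G} {H = restrict a b G} (restrict-⊆ a b G) nc ,
      (λ i j e′ → proj₁ (proj₂ (restrict-adj a b G e′))) , trans (edgesIn-restrict G a b) full
      where b = a + suc e

    glue-restrict : ∀ G a b m → Simple G → Within a b G → Splits G a b m → Σ (Fin n × Fin n) (ChordEdge G a b) →
                    G ≡ glue a b (restrict a m G) (restrict m b G)
    glue-restrict G a b m s w (_ , _ , jump) ((x , y) , x≡a , y≡b , xy) = graph-ext to from
      where
      H : Graph n
      H = glue a b (restrict a m G) (restrict m b G)
      Side : Fin n → Fin n → Set
      Side i j = (InRange a m i × InRange a m j) ⊎ (InRange m b i × InRange m b j) ⊎ Chord a b i j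
      side< : ∀ i j → Adj G i j → toℕ i < toℕ j → Side i j
      side< i j e i<j with within-both G s w i j e
      ... | (a≤i , i≤b) , (a≤j , j≤b) with toℕ j ≤? m
      ...   | yes j≤m = inj₁ ((a≤i , ≤-trans (<⇒≤ i<j) j≤m) , (a≤j , j≤m))
      ...   | no  j≰m with m ≤? toℕ i
      ...     | yes m≤i = inj₂ (inj₁ ((m≤i , i≤b) , (≤-trans m≤i (<⇒≤ i<j) , j≤b)))
      ...     | no  m≰i = inj₂ (inj₂ (inj₁ (jump i j e a≤i (≰⇒> m≰i) (≰⇒> j≰m) j≤b)))
      side : ∀ i j → Adj G i j → Side i j
      side i j e with <-cmp (toℕ i) (toℕ j)
      ... | tri< i<j _ _ = side< i j e i<j
      ... | tri≈ _ i≡j _ = ⊥-elim (proj₁ s i (subst (Adj G i) (sym (toℕ-injective i≡j)) e))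
      ... | tri> _ _ j<i = Sum.map Product.swap (Sum.map Product.swap chord-sym)
                             (side< j i (proj₂ s i j e) j<i)
      to : ∀ i j → Adj G i j → Adj H i j
      to i j e = adj-glue a b (restrict a m G) (restrict m b G) (Sum.map (λ (i∈ , j∈) → adj-restrict a m G e i∈ j∈)
                                    (Sum.map (λ (i∈ , j∈) → adj-restrict m b G e i∈ j∈) (λ c → c)) (side i j e))
      from : ∀ i j → Adj H i j → Adj G i j
      from i j e with glue-adj a b (restrict a m G) (restrict m b G) e
      ... | inj₁ e₁ = restrict-⊆ a m G i j e₁
      ... | inj₂ (inj₁ e₂) = restrict-⊆ m b G i j e₂
      ... | inj₂ (inj₂ (inj₁ (i≡a , j≡b))) =
        subst₂ (Adj G) (toℕ-injective (trans x≡a (sym i≡a))) (toℕ-injective (trans y≡b (sym j≡b))) xy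
      ... | inj₂ (inj₂ (inj₂ (i≡b , j≡a))) =
        subst₂ (Adj G) (toℕ-injective (trans y≡b (sym i≡b))) (toℕ-injective (trans x≡a (sym j≡a))) (proj₂ s x y xy)

    -- Decomposition of a triangulation of a … a + d + 2 along the apex m of the triangle on
    -- the chord (a, a + d + 2): triangulations of both sides, glued along that chord.
    record Decomposition (G : Graph n) (a d : ℕ) : Set where
      field
        parts : Split G a d
      open Split parts public
      field
        tri₁ : Tri a e (restrict a m G)
        tri₂ : Tri m f (restrict m (m + suc f) G)
        chord₁ : Σ (Fin n × Fin n) (ChordEdge G a m)
        glued : G ≡ glue a (a + suc (suc d)) (restrict a m G) (restrict m (a + suc (suc d)) G)

    decompose : ∀ a d G → Tri a (suc d) G → Decomposition G a d
    decompose a d G (s , nc , w , full) = record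
      { parts = parts
      ; tri₁ = restrict-tri G a e s nc left
      ; tri₂ = restrict-tri G m f s nc right
      ; chord₁ = saturated-chord G nc a e left
      ; glued = glue-restrict G a _ m s w splits (saturated-chord G nc a (suc d) full) }
      where
      parts = split G nc a d
      open Split parts
      left : Saturated G a e
      left = proj₁ (saturated-split G nc a d full parts)
      right : Saturated G m f
      right = proj₁ (proj₂ (saturated-split G nc a d full parts))

    tri-reaches : ∀ d a G → Tri a d G → ∀ x → toℕ x ≡ a → ∀ v → InRange a (a + suc d) v → Reach G v x
    tri-reaches = <-rec _ reaches
      where
      reaches : ∀ d → (∀ {d′} → d′ < d → ∀ a G → Tri a d′ G → ∀ x → toℕ x ≡ a → ∀ v → InRange a (a + suc d′) v → Reach G v x) →
                ∀ a G → Tri a d G → ∀ x → toℕ x ≡ a → ∀ v → InRange a (a + suc d) v → Reach G v x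
      reaches zero _ a G (s , nc , _ , full) x x≡a v (a≤v , v≤a+1) with saturated-chord G nc a 0 full | toℕ v ≟ a
      ... | _ | yes v≡a = subst (λ z → Reach G z x) (toℕ-injective (trans x≡a (sym v≡a))) here
      ... | (p , q) , p≡a , q≡a+1 , pq | no v≢a = step (subst₂ (Adj G) q≡v p≡x (proj₂ s p q pq)) here
        where
        p≡x : p ≡ x
        p≡x = toℕ-injective (trans p≡a (sym x≡a))
        q≡v : q ≡ v
        q≡v = toℕ-injective (trans q≡a+1 (sym (≤-antisym v≤a+1 (subst (_≤ toℕ v) (+-comm 1 a) (≤∧≢⇒< a≤v (λ a≡v → v≢a (sym a≡v)))))))
      reaches (suc d) rec a G t@(s , _) x x≡a v (a≤v , v≤b) = toA
        where
        open Decomposition (decompose a d G t)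
        lift : ∀ c c′ {u w} → Reach (restrict c c′ G) u w → Reach G u w
        lift c c′ = reach-mono (restrict-⊆ c c′ G)
        viaApex : m < toℕ v → Σ (Fin n × Fin n) (ChordEdge G a m) → Reach G v x
        viaApex m<v ((p , q) , p≡a , q≡m , pq) =
          reach-snoc (lift m (m + suc f) (rec (s≤s f≤d) m (restrict m (m + suc f) G) tri₂ q q≡m v (<⇒≤ m<v , subst (toℕ v ≤_) b≡ v≤b)))
                     (subst (Adj G q) (toℕ-injective (trans p≡a (sym x≡a))) (proj₂ s p q pq))
        -- left of the apex use the left triangulation; right of it, reach the apex first
        toA : Reach G v x
        toA with toℕ v ≤? m
        ... | yes v≤m = lift a m (rec (s≤s e≤d) a (restrict a m G) tri₁ x x≡a v (a≤v , v≤m))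
        ... | no  v≰m = viaApex (≰⇒> v≰m) chord₁

    -- Triangulations of a … a + d + 2 correspond to the pairs of triangulations of
    -- a … a + j + 1 and a + j + 1 … a + d + 2 (j ≤ d): glue them along the chord (a, a + d + 2).
    module GluingBijection (a d : ℕ) where

      b : ℕ
      b = a + suc (suc d)

      Pieces : ℕ × (Graph n × Graph n) → Set
      Pieces (j , h₁ , h₂) = j < suc d × Tri a j h₁ × Tri (a + suc j) (d ∸ j) h₂

      glueP : ℕ × (Graph n × Graph n) → Graph n
      glueP (j , h₁ , h₂) = glue a b h₁ h₂

      adjacent : ∀ j h₁ h₂ → Pieces (j , h₁ , h₂) → Adjacent a (a + suc j) b h₁ h₂
      adjacent j h₁ h₂ (j<1+d , (s₁ , nc₁ , w₁ , _) , (s₂ , nc₂ , w₂ , _)) = record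
        { simple₁ = s₁ ; nc₁ = nc₁ ; within₁ = w₁ ; simple₂ = s₂ ; nc₂ = nc₂
        ; within₂ = subst (λ z → Within (a + suc j) z h₂) meet w₂
        ; a<m = m<m+n a z<s
        ; m<b = subst (a + suc j <_) meet (m<m+n (a + suc j) z<s) }
        where
        meet : a + suc j + suc (d ∸ j) ≡ b
        meet = ends-meet a j d (≤-pred j<1+d)

      chords : ∀ j h₁ h₂ → Pieces (j , h₁ , h₂) →
               Σ (Fin n × Fin n) (ChordEdge h₁ a (a + suc j)) × Σ (Fin n × Fin n) (ChordEdge h₂ (a + suc j) b)
      chords j h₁ h₂ (j<1+d , (_ , nc₁ , _ , full₁) , (_ , nc₂ , _ , full₂)) =
        saturated-chord h₁ nc₁ a j full₁ ,
        subst (λ z → Σ (Fin n × Fin n) (ChordEdge h₂ (a + suc j) z)) (ends-meet a j d (≤-pred j<1+d))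
              (saturated-chord h₂ nc₂ (a + suc j) (d ∸ j) full₂)

      glue-tri : ∀ x → Pieces x → Tri a (suc d) (glueP x)
      glue-tri (j , h₁ , h₂) pieces@(j<1+d , (_ , _ , _ , full₁) , (_ , _ , _ , full₂)) = withEnds (chords j h₁ h₂ pieces)
        where
        open Glued (adjacent j h₁ h₂ pieces)
        meet : a + suc j + suc (d ∸ j) ≡ b
        meet = ends-meet a j d (≤-pred j<1+d)
        withEnds : Σ (Fin n × Fin n) (ChordEdge h₁ a (a + suc j)) × Σ (Fin n × Fin n) (ChordEdge h₂ (a + suc j) b) →
                   Tri a (suc d) (glue a b h₁ h₂)
        withEnds (((x , _) , x≡a , _) , ((_ , y) , _ , y≡b , _)) =
          simple , nonCrossing , within , (begin
            edgesIn (glue a b h₁ h₂) a b                                ≡⟨ edgesIn-glue (x , y) x≡a y≡b ⟩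
            edgesIn h₁ a (a + suc j) + edgesIn h₂ (a + suc j) b + 1     ≡⟨ cong (λ z → edgesIn h₁ a (a + suc j) + edgesIn h₂ (a + suc j) z + 1) (sym meet) ⟩
            edgesIn h₁ a (a + suc j) + edgesIn h₂ (a + suc j) (a + suc j + suc (d ∸ j)) + 1
                                                                        ≡⟨ cong₂ (λ u v → u + v + 1) full₁ full₂ ⟩
            suc (j + j) + suc ((d ∸ j) + (d ∸ j)) + 1                   ≡⟨ sides-add-up j (d ∸ j) ⟩
            suc (suc (j + (d ∸ j)) + suc (j + (d ∸ j)))                 ≡⟨ cong (λ z → suc (suc z + suc z)) (m+[n∸m]≡n (≤-pred j<1+d)) ⟩
            suc (suc d + suc d)                                         ∎)
          where open ≡-Reasoning

      -- Two gluings of the same graph have the same apex: otherwise the chord from a to the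
      -- farther apex would cross the chord from the nearer apex to b.
      apex-≤ : ∀ j h₁ h₂ j′ h₁′ h₂′ → Pieces (j , h₁ , h₂) → Pieces (j′ , h₁′ , h₂′) →
               glue a b h₁ h₂ ≡ glue a b h₁′ h₂′ → ¬ j < j′
      apex-≤ j h₁ h₂ j′ h₁′ h₂′ pieces pieces′ same j<j′ =
        crossing (proj₁ (chords j′ h₁′ h₂′ pieces′)) (proj₂ (chords j h₁ h₂ pieces))
        where
        crossing : Σ (Fin n × Fin n) (ChordEdge h₁′ a (a + suc j′)) → Σ (Fin n × Fin n) (ChordEdge h₂ (a + suc j) b) → ⊥
        crossing ((p , q) , p≡a , q≡m′ , pq) ((p₂ , q₂) , p₂≡m , q₂≡b , p₂q₂) =
          Glued.nonCrossing (adjacent j h₁ h₂ pieces) p q p₂ q₂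
            (subst (λ H → Adj H p q) (sym same) (adj-glue a b h₁′ h₂′ (inj₁ pq)))
            (adj-glue a b h₁ h₂ (inj₂ (inj₁ p₂q₂)))
            (subst₂ _<_ (sym p≡a) (sym p₂≡m) (m<m+n a z<s))
            (subst₂ _<_ (sym p₂≡m) (sym q≡m′) (+-monoʳ-< a (s≤s j<j′)))
            (subst₂ _<_ (sym q≡m′) (sym q₂≡b) (Adjacent.m<b (adjacent j′ h₁′ h₂′ pieces′)))

      glue-injective : ∀ x y → Pieces x → Pieces y → glueP x ≡ glueP y → x ≡ y
      glue-injective (j , h₁ , h₂) (j′ , h₁′ , h₂′) pieces pieces′ same with <-cmp j j′
      ... | tri< j<j′ _ _ = ⊥-elim (apex-≤ j h₁ h₂ j′ h₁′ h₂′ pieces pieces′ same j<j′)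
      ... | tri> _ _ j′<j = ⊥-elim (apex-≤ j′ h₁′ h₂′ j h₁ h₂ pieces′ pieces (sym same) j′<j)
      ... | tri≈ _ refl _ = cong₂ (λ u v → j , u , v)
        (trans (sym (Glued.restrict-glue₁ (adjacent j h₁ h₂ pieces)))
               (trans (cong (restrict a (a + suc j)) same) (Glued.restrict-glue₁ (adjacent j h₁′ h₂′ pieces′))))
        (trans (sym (Glued.restrict-glue₂ (adjacent j h₁ h₂ pieces)))
               (trans (cong (restrict (a + suc j) b) same) (Glued.restrict-glue₂ (adjacent j h₁′ h₂′ pieces′))))

      glue-onto : ∀ G → Tri a (suc d) G → Σ (ℕ × (Graph n × Graph n)) λ x → Pieces x × glueP x ≡ G
      glue-onto G t = (e , restrict a m G , restrict m b G) ,
                      (s≤s e≤d , tri₁ , subst (λ z → Tri m f (restrict m z G)) (sym b≡) tri₂) ,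
                      sym glued
        where open Decomposition (decompose a d G t)

    unitChord? : ∀ a (i j : Fin n) → Dec (Chord a (a + 1) i j)
    unitChord? a = chord? a (a + 1)

    unitChord : ℕ → Graph n
    unitChord a = graphOf (unitChord? a)

    unitChord-tri : ∀ a → a + 1 < n → Tri a 0 (unitChord a)
    unitChord-tri a a+1<n =
      ((λ i e → loopless (adj-graphOf (unitChord? a) {i} {i} e)) ,
       (λ i j e → graphOf-adj (unitChord? a) {j} {i} (chord-sym (adj-graphOf (unitChord? a) {i} {j} e)))) ,
      (λ w x y z e₁ e₂ w<y y<x x<z → uncrossed (adj-graphOf (unitChord? a) {w} {x} e₁) w<y y<x) ,
      (λ i j e → inRange (adj-graphOf (unitChord? a) {i} {j} e)) ,
      count-unique (count-edgesIn (unitChord a) a (a + 1)) (count-resp into onto (count-single (fa , fb)))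
      where
      fa fb : Fin n
      fa = fromℕ< (≤-<-trans (m≤m+n a 1) a+1<n)
      fb = fromℕ< a+1<n
      a<a+1 : a < a + 1
      a<a+1 = m<m+n a z<s
      loopless : ∀ {i} → ¬ Chord a (a + 1) i i
      loopless (inj₁ (i≡a , i≡a+1)) = <-irrefl (trans (sym i≡a) i≡a+1) a<a+1
      loopless (inj₂ (i≡a+1 , i≡a)) = <-irrefl (trans (sym i≡a) i≡a+1) a<a+1
      -- no position lies strictly between a and a + 1
      uncrossed : ∀ {w x y} → Chord a (a + 1) w x → toℕ w < toℕ y → toℕ y < toℕ x → ⊥
      uncrossed {y = y} (inj₁ (w≡a , x≡a+1)) w<y y<x =
        <-irrefl refl (<-≤-trans (subst (toℕ y <_) x≡a+1 y<x) (subst (_≤ toℕ y) (+-comm 1 a) (subst (_< toℕ y) w≡a w<y)))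
      uncrossed (inj₂ (w≡a+1 , x≡a)) w<y y<x =
        <-irrefl refl (<-trans (subst (_ <_) x≡a y<x) (<-trans a<a+1 (subst (_< _) w≡a+1 w<y)))
      inRange : ∀ {i j} → Chord a (a + 1) i j → InRange a (a + 1) i
      inRange (inj₁ (i≡a , _)) = ≤-reflexive (sym i≡a) , subst (_≤ a + 1) (sym i≡a) (<⇒≤ a<a+1)
      inRange (inj₂ (i≡a+1 , _)) = subst (a ≤_) (sym i≡a+1) (<⇒≤ a<a+1) , ≤-reflexive i≡a+1
      into : ∀ p → p ≡ (fa , fb) → EdgeIn (unitChord a) a (a + 1) p
      into _ refl = (≤-reflexive (sym (toℕ-fromℕ< _)) , subst₂ _<_ (sym (toℕ-fromℕ< _)) (sym (toℕ-fromℕ< a+1<n)) a<a+1 ,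
                     ≤-reflexive (toℕ-fromℕ< a+1<n)) ,
                    graphOf-adj (unitChord? a) (inj₁ (toℕ-fromℕ< _ , toℕ-fromℕ< a+1<n))
      onto : ∀ p → EdgeIn (unitChord a) a (a + 1) p → p ≡ (fa , fb)
      onto (i , j) e = let (i≡a , j≡a+1 , _) = unit-interval (unitChord a) a (i , j) e in
        cong₂ _,_ (toℕ-injective (trans i≡a (sym (toℕ-fromℕ< _)))) (toℕ-injective (trans j≡a+1 (sym (toℕ-fromℕ< a+1<n))))

    unitChord-unique : ∀ a G → Tri a 0 G → G ≡ unitChord a
    unitChord-unique a G (s , nc , w , full) = graph-ext to from
      where
      to : ∀ i j → Adj G i j → Adj (unitChord a) i j
      to i j e with <-cmp (toℕ i) (toℕ j) | within-both G s w i j e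
      ... | tri< i<j _ _ | (a≤i , _) , (_ , j≤a+1) =
        let (i≡a , j≡a+1 , _) = unit-interval G a (i , j) ((a≤i , i<j , j≤a+1) , e)
        in graphOf-adj (unitChord? a) (inj₁ (i≡a , j≡a+1))
      ... | tri≈ _ i≡j _ | _ = ⊥-elim (proj₁ s i (subst (Adj G i) (sym (toℕ-injective i≡j)) e))
      ... | tri> _ _ j<i | (_ , i≤a+1) , (a≤j , _) =
        let (j≡a , i≡a+1 , _) = unit-interval G a (j , i) ((a≤j , j<i , i≤a+1) , proj₂ s i j e)
        in graphOf-adj (unitChord? a) (inj₂ (i≡a+1 , j≡a))
      from : ∀ i j → Adj (unitChord a) i j → Adj G i j
      from i j e with adj-graphOf (unitChord? a) e | saturated-chord G nc a 0 full
      ... | inj₁ (i≡a , j≡a+1) | (p , q) , p≡a , q≡a+1 , pq =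
        subst₂ (Adj G) (toℕ-injective (trans p≡a (sym i≡a))) (toℕ-injective (trans q≡a+1 (sym j≡a+1))) pq
      ... | inj₂ (i≡a+1 , j≡a) | (p , q) , p≡a , q≡a+1 , pq =
        subst₂ (Adj G) (toℕ-injective (trans q≡a+1 (sym i≡a+1))) (toℕ-injective (trans p≡a (sym j≡a))) (proj₂ s p q pq)

    count-tri : ∀ d a → a + suc d < n → HasCount (Tri a d) (Cat d)
    count-tri = <-rec _ counting
      where
      counting : ∀ d → (∀ {d′} → d′ < d → ∀ a → a + suc d′ < n → HasCount (Tri a d′) (Cat d′)) →
                 ∀ a → a + suc d < n → HasCount (Tri a d) (Cat d)
      counting zero    _   a a+1<n =
        count-resp (λ { G refl → unitChord-tri a a+1<n }) (unitChord-unique a) (count-single (unitChord a))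
      counting (suc d) rec a b<n =
        subst (HasCount (Tri a (suc d))) (sym (segner d))
          (count-image (Tri a (suc d)) glueP (count-Σ _ _ (suc d) pieceCounts) glue-injective glue-tri glue-onto)
        where
        open GluingBijection a d
        pieceCounts : ∀ j → j < suc d → HasCount (λ (h : Graph n × Graph n) → Tri a j (proj₁ h) × Tri (a + suc j) (d ∸ j) (proj₂ h))
                                                  (Cat j * Cat (d ∸ j))
        pieceCounts j j<1+d = count-×
          (rec j<1+d a (<-trans (+-monoʳ-< a (s≤s j<1+d)) b<n))
          (rec (s≤s (m∸n≤m d j)) (a + suc j) (subst (_< n) (sym (ends-meet a j d (≤-pred j<1+d))) b<n))

module WholePolygon where

  open import Defs
  open Counting
  open FiniteGraphs
  open Intervals
  open Triangulations
  open Catalan using (Cat; catalan-closed)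
  open import Data.Nat using (ℕ; suc; _+_; _*_; _∸_; z≤n)
  open import Data.Nat.Properties using (≤-pred; ≤-refl; m+n∸n≡m)
  open import Data.Nat.Combinatorics using (_C_)
  open import Data.Nat.Tactic.RingSolver using (solve-∀)
  open import Data.Fin using (zero)
  open import Data.Fin.Properties using (toℕ-injective; toℕ<n)
  open import Data.Product using (_×_; _,_; proj₁; proj₂; ∃)
  open import Relation.Binary.PropositionalEquality using (_≡_; refl; sym; trans; cong; subst; subst₂)

  module _ (m : ℕ) where

    private
      n : ℕ
      n = suc (suc m)

    triangulation-size : 2 * n ∸ 3 ≡ suc (m + m)
    triangulation-size = trans (cong (_∸ 3) (shape m)) (m+n∸n≡m (suc (m + m)) 3)
      where
      shape : ∀ m → 2 * suc (suc m) ≡ suc (m + m) + 3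
      shape = solve-∀

    edges-everywhere : ∀ G k → HasEdges k G → edgesIn G 0 (suc m) ≡ k
    edges-everywhere G k hk = count-unique (count-edgesIn G 0 (suc m))
      (count-resp (λ (i , j) (i<j , e) → (z≤n , i<j , ≤-pred (toℕ<n j)) , e) (λ _ (range , e) → proj₁ (proj₂ range) , e) hk)

    maximal→tri : ∀ G → NCGraph (2 * n ∸ 3) G → Tri 0 m G
    maximal→tri G (s , nc , edges) =
      s , nc , (λ i _ _ → z≤n , ≤-pred (toℕ<n i)) , trans (edges-everywhere G _ edges) triangulation-size

    tri→maximal : ∀ G → Tri 0 m G → NCGraph (2 * n ∸ 3) G
    tri→maximal G (s , nc , _ , full) =
      s , nc , count-resp (λ _ (range , e) → proj₁ (proj₂ range) , e) (λ (i , j) (i<j , e) → (z≤n , i<j , ≤-pred (toℕ<n j)) , e)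
                          (subst (HasCount _) (trans full (sym triangulation-size)) (count-edgesIn G 0 (suc m)))

    tri-connected : ∀ G → Tri 0 m G → Connected G
    tri-connected G t = connected-via zero (proj₂ (proj₁ t)) (λ v → tri-reaches m 0 G t zero refl v (z≤n , ≤-pred (toℕ<n v)))

    tri-outer : ∀ G → Tri 0 m G → ∀ i j → FirstLast n i j → Adj G i j
    tri-outer G (_ , nc , _ , full) i j (i≡0 , j≡n-1) with saturated-chord G nc 0 m full
    ... | (p , q) , p≡0 , q≡n-1 , pq = subst₂ (Adj G) (toℕ-injective (trans p≡0 (sym i≡0))) (toℕ-injective (trans q≡n-1 (sym j≡n-1))) pq

    maximal-count : ∃ λ f → ∃ λ c →
      HasCount (ConnNCWithEdge n (2 * n ∸ 3)) f × HasCount (ConnNC n (2 * n ∸ 3)) c ×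
      f ≡ c × (n ∸ 1) * c ≡ (2 * n ∸ 4) C (n ∸ 2)
    maximal-count = Cat m , Cat m ,
      count-resp (λ G t → (tri→maximal G t , tri-connected G t) , tri-outer G t) (λ G conn → maximal→tri G (proj₁ (proj₁ conn))) triangulations ,
      count-resp (λ G t → tri→maximal G t , tri-connected G t) (λ G conn → maximal→tri G (proj₁ conn)) triangulations ,
      refl ,
      trans (catalan-closed m) (cong (_C m) (sym (trans (cong (_∸ 4) (shape m)) (m+n∸n≡m (m + m) 4))))
      where
      triangulations : HasCount (Tri 0 m) (Cat m)
      triangulations = count-tri m 0 ≤-refl
      shape : ∀ m → 2 * suc (suc m) ≡ m + m + 4
      shape = solve-∀

open import Data.Nat using (z≤n; s≤s)
open import Data.Product using (_,_)
open OuterChord using (edge-recurrence)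
open WholePolygon using (maximal-count)

mainTheorem6 : ∀ (n : ℕ) → 2 ≤ n →
    (∀ (k : ℕ) → ∃ λ f → ∃ λ f′ → ∃ λ c → ∃ λ d →
        HasCount (ConnNCWithEdge n k) f × HasCount (ConnNCWithEdge n (suc k)) f′ ×
        HasCount (ConnNC n k) c × HasCount (TwoCompNC n k) d ×
        f + f′ ≡ c + d)
    × (∃ λ f → ∃ λ c →
        HasCount (ConnNCWithEdge n (2 * n ∸ 3)) f × HasCount (ConnNC n (2 * n ∸ 3)) c ×
        f ≡ c × (n ∸ 1) * c ≡ (2 * n ∸ 4) C (n ∸ 2))
mainTheorem6 (suc (suc m)) (s≤s (s≤s z≤n)) = edge-recurrence m , maximal-count m
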